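{- For $k\ge0$, $$W_{113\text{ - }2}(x;k)=1+\sum_{j=0}^{k-1}\sum_{i=j}^{k-1}a_{i,j}W_{113\text{ - }2}(x;k-j),$$ where $a_{i,j}$ denotes the coefficient of $y^j$ in the polynomial (in $y$) $$\frac{x\,(x^2(1-y)+y)^{i/2}}{1+y}\left(2y\,T_i\!\left(\frac{1+y}{2\sqrt{x^2(1-y)+y}}\right)+(1-y)\,U_i\!\left(\frac{1+y}{2\sqrt{x^2(1-y)+y}}\right)\right).$$
   Context: For $k\ge1$ let $[k]=\{1,\dots,k\}$; a $k$-ary word of length $n$ is an element of $[k]^n$ ($[0]^n$ is empty for $n\ge1$; the empty word is the unique word of length $0$). Two words are order-isomorphic if replacing the $i$-th smallest distinct letter by $i$ yields the same word. A word $w=w_1\cdots w_n$ contains the vincular pattern $113\text{ - }2$ if there are indices $p$ and $q\ge p+3$ with $w_pw_{p+1}w_{p+2}w_q$ order-isomorphic to $1132$; otherwise it avoids it. $a_{113\text{ - }2}(n,k)$ is the number of words in $[k]^n$ avoiding it, and $W_{113\text{ - }2}(x;k)=\sum_{n\ge0}a_{113\text{ - }2}(n,k)x^n$. $T_i$ and $U_i$ are the Chebyshev polynomials of the first and second kind: $T_0=1$, $T_1(t)=t$, $U_0=1$, $U_1(t)=2t$, and $P_i(t)=2tP_{i-1}(t)-P_{i-2}(t)$ for $i\ge2$, $P\in\{T,U\}$. An empty sum equals $0$. -}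

module Defs where

open import Data.Nat as ℕ using (ℕ; zero; suc; _∸_; _≤?_; _<?_)
import Data.Nat.Properties as ℕP
open import Data.Nat.DivMod using (_/_)
open import Data.Integer using (+_)
open import Data.Rational as ℚ using (ℚ; 0ℚ; 1ℚ; ½; _+_; _*_; -_)
open import Data.Fin using (Fin; toℕ)
open import Data.Fin.Properties using (any?)
open import Data.Vec using (Vec; []; _∷_)
import Data.Vec as Vec
open import Data.List using (List; []; _∷_; map; length; filter; concatMap; deduplicate)
import Data.List.Properties as LP
open import Data.List.Relation.Binary.Pointwise using ()
open import Data.Product using (∃; _×_; _,_)
open import Relation.Nullary using (Dec; ¬_; ¬?; _×-dec_)
open import Relation.Binary.PropositionalEquality using (_≡_)

-- natural-number value of the letter at position i (0-based), default 0
at : ∀ {n k} → Vec (Fin k) n → ℕ → ℕ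
at []       _       = 0
at (c ∷ w) zero    = toℕ c
at (c ∷ w) (suc i) = at w i

reduce : List ℕ → List ℕ
reduce u = map (λ c → suc (length (deduplicate ℕP._≟_ (filter (λ d → d <? c) u)))) u

OrderIso : List ℕ → List ℕ → Set
OrderIso u v = reduce u ≡ reduce v

orderIso? : (u v : List ℕ) → Dec (OrderIso u v)
orderIso? u v = LP.≡-dec ℕP._≟_ (reduce u) (reduce v)

pattern1132 : List ℕ
pattern1132 = 1 ∷ 1 ∷ 3 ∷ 2 ∷ []

sub4 : ∀ {n k} → Vec (Fin k) n → ℕ → ℕ → List ℕ
sub4 w p q = at w p ∷ at w (suc p) ∷ at w (suc (suc p)) ∷ at w q ∷ []

-- w contains 113-2: positions p, q with q ≥ p+3 and w_p w_{p+1} w_{p+2} w_q ~ 1132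
-- (q < n forces p+1, p+2 < n, so all lookups are genuine)
Contains : ∀ {n k} → Vec (Fin k) n → Set
Contains {n} w = ∃ λ (p : Fin n) → ∃ λ (q : Fin n) →
  (suc (suc (suc (toℕ p))) ℕ.≤ toℕ q) × OrderIso (sub4 w (toℕ p) (toℕ q)) pattern1132

contains? : ∀ {n k} (w : Vec (Fin k) n) → Dec (Contains w)
contains? w = any? λ p → any? λ q →
  (suc (suc (suc (toℕ p))) ≤? toℕ q) ×-dec orderIso? (sub4 w (toℕ p) (toℕ q)) pattern1132

-- all words of [k]^n (letters Fin k, i.e. letter i+1 represented by i)
allWords : (n k : ℕ) → List (Vec (Fin k) n)
allWords zero    k = [] ∷ []
allWords (suc n) k = concatMap (λ c → map (c ∷_) (allWords n k)) (Data.List.allFin k)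

avoiders : ℕ → ℕ → ℕ
avoiders n k = length (filter (λ w → ¬? (contains? w)) (allWords n k))

Σ< : ℕ → (ℕ → ℚ) → ℚ
Σ< zero    f = 0ℚ
Σ< (suc n) f = Σ< n f + f n

fromℕ : ℕ → ℚ
fromℕ n = (+ n) ℚ./ 1

δ0 : ℕ → ℚ
δ0 zero    = 1ℚ
δ0 (suc _) = 0ℚ

-- Chebyshev polynomials as coefficient sequences (coef of t^m)

shift : (ℕ → ℚ) → ℕ → ℚ
shift f zero    = 0ℚ
shift f (suc m) = f m

δ : ℕ → ℕ → ℚ
δ zero    zero    = 1ℚ
δ zero    (suc _) = 0ℚ
δ (suc _) zero    = 0ℚ
δ (suc a) (suc b) = δ a b

two : ℚ
two = fromℕ 2

chebT : ℕ → ℕ → ℚ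
chebT zero          = δ 0
chebT (suc zero)    = δ 1
chebT (suc (suc i)) m = two * shift (chebT (suc i)) m + - chebT i m

chebU : ℕ → ℕ → ℚ
chebU zero          = δ 0
chebU (suc zero)  m = two * δ 1 m
chebU (suc (suc i)) m = two * shift (chebU (suc i)) m + - chebU i m

-- Bivariate polynomials in x, y: P2 m j = coefficient of x^m y^j

P2 : Set
P2 = ℕ → ℕ → ℚ

cst : ℚ → P2
cst c m j = c * δ 0 m * δ 0 j

X Y : P2
X m j = δ 1 m * δ 0 j
Y m j = δ 0 m * δ 1 j

_⊕_ _⊖_ _⊗_ : P2 → P2 → P2
(f ⊕ g) m j = f m j + g m j
(f ⊖ g) m j = f m j + - g m j
(f ⊗ g) m j = Σ< (suc m) λ a → Σ< (suc j) λ b → f a b * g (m ∸ a) (j ∸ b)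

pow : P2 → ℕ → P2
pow f zero    = cst 1ℚ
pow f (suc e) = f ⊗ pow f e

S Z : P2
S = cst 1ℚ ⊕ Y
Z = ((X ⊗ X) ⊗ (cst 1ℚ ⊖ Y)) ⊕ Y

-- z^{i/2} P_i( s / (2 sqrt z) ) for a Chebyshev polynomial P_i = Σ_m c_m t^m
-- of parity i:  Σ_{l ≤ ⌊i/2⌋} c_{i-2l} (s/2)^{i-2l} z^l
homog : (ℕ → ℕ → ℚ) → ℕ → P2
homog c i m j = Σ< (suc (i / 2)) (λ l →
  (cst (c i (i ∸ (l ℕ.+ l))) ⊗ (pow (cst ½ ⊗ S) (i ∸ (l ℕ.+ l)) ⊗ pow Z l)) m j)

-- numerator x (2y T̃_i + (1-y) Ũ_i), before division by (1+y)
numer : ℕ → P2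
numer i = X ⊗ (((cst two ⊗ Y) ⊗ homog chebT i) ⊕ ((cst 1ℚ ⊖ Y) ⊗ homog chebU i))

sign : ℕ → ℚ
sign zero    = 1ℚ
sign (suc e) = - sign e

-- [x^m] a_{i,j}, where a_{i,j} = [y^j] numer_i / (1+y)  (1/(1+y) = Σ (-y)^r)
coefA : ℕ → ℕ → ℕ → ℚ
coefA i j m = Σ< (suc j) λ l → sign (j ∸ l) * numer i m l

-- Let Φ a k n count the avoiders of length n over [k] with first letter k - a, so that
-- a_{113-2}(n, k) = δ_{n,0} + Σ_{a<k} Φ a k n.  Splitting c d w according to whether d = c,
-- and noting that in an avoider c c e w (c < e) no letter of w lies strictly between c and e,
-- so that those letters can be deleted, gives
--   Φ a k (n+2) = a_{113-2}(n+1, k) - Σ_{a′<a} (Φ a′ k n - Φ a′ (k - (a - 1 - a′)) n).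
-- On the algebraic side, with s = 1 + y and z = x²(1 - y) + y the homogenised Chebyshev
-- polynomials z^{i/2} P_i(s / 2√z) obey P_{i+2} = s P_{i+1} - z P_i, hence the numerator of
-- a_{i,j} is (1 + y) ψ_i for polynomials ψ_0 = ψ_1 = x, ψ_{i+2} = s ψ_{i+1} - z ψ_i, and
-- a_{i,j} = [y^j] ψ_i.  The same recurrence telescopes to ψ_a = x - x² Σ_{a′<a} (1 - y^{a-1-a′}) ψ_{a′},
-- so [x^n] Σ_j [y^j] ψ_a · W_{k-j}(x), with W_k(x) the generating function of a_{113-2}(·, k),
-- satisfies the recurrence of Φ a k n, and the two agree.
-- Finally ψ_a has y-degree at most a, which turns Σ_a into the double sum over j ≤ i < k.

module Submission where

open import Algebra.Bundles using (CommutativeSemiring; CommutativeRing)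
open import Data.Nat using (ℕ)
open import Data.Rational using (ℚ)

module FiniteSum {c ℓ} (R : CommutativeSemiring c ℓ) where

  open import Data.Nat as ℕ using (ℕ; zero; suc; _∸_; _≤_; _<_)
  import Data.Nat.Properties as ℕP
  open import Relation.Binary.PropositionalEquality as P using (_≡_; _≢_)
  open import Data.Sum using (inj₁; inj₂)
  open CommutativeSemiring R
  open import Relation.Binary.Reasoning.Setoid setoid

  Σ : ℕ → (ℕ → Carrier) → Carrier
  Σ zero    f = 0#
  Σ (suc n) f = Σ n f + f n

  Σ-cong< : ∀ n {f g} → (∀ i → i < n → f i ≈ g i) → Σ n f ≈ Σ n g
  Σ-cong< zero    h = refl
  Σ-cong< (suc n) h = +-cong (Σ-cong< n (λ i i<n → h i (ℕP.m<n⇒m<1+n i<n))) (h n ℕP.≤-refl)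

  Σ-cong : ∀ n {f g} → (∀ i → f i ≈ g i) → Σ n f ≈ Σ n g
  Σ-cong n h = Σ-cong< n (λ i _ → h i)

  Σ-zero : ∀ n {f} → (∀ i → i < n → f i ≈ 0#) → Σ n f ≈ 0#
  Σ-zero n {f} h = trans (Σ-cong< n h) (Σ-0# n)
    where
    Σ-0# : ∀ n → Σ n (λ _ → 0#) ≈ 0#
    Σ-0# zero    = refl
    Σ-0# (suc n) = trans (+-identityʳ _) (Σ-0# n)

  Σ-+ : ∀ n f g → Σ n (λ i → f i + g i) ≈ Σ n f + Σ n g
  Σ-+ zero    f g = sym (+-identityˡ 0#)
  Σ-+ (suc n) f g = begin
    Σ n (λ i → f i + g i) + (f n + g n) ≈⟨ +-congʳ (Σ-+ n f g) ⟩
    (Σ n f + Σ n g) + (f n + g n)       ≈⟨ +-assoc _ _ _ ⟩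
    Σ n f + (Σ n g + (f n + g n))       ≈⟨ +-congˡ (sym (+-assoc _ _ _)) ⟩
    Σ n f + ((Σ n g + f n) + g n)       ≈⟨ +-congˡ (+-congʳ (+-comm _ _)) ⟩
    Σ n f + ((f n + Σ n g) + g n)       ≈⟨ +-congˡ (+-assoc _ _ _) ⟩
    Σ n f + (f n + (Σ n g + g n))       ≈⟨ sym (+-assoc _ _ _) ⟩
    (Σ n f + f n) + (Σ n g + g n)       ∎

  *-distribˡ-Σ : ∀ n x f → x * Σ n f ≈ Σ n (λ i → x * f i)
  *-distribˡ-Σ zero    x f = zeroʳ x
  *-distribˡ-Σ (suc n) x f = trans (distribˡ x _ _) (+-congʳ (*-distribˡ-Σ n x f))

  *-distribʳ-Σ : ∀ n x f → Σ n f * x ≈ Σ n (λ i → f i * x)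
  *-distribʳ-Σ n x f = trans (*-comm _ _) (trans (*-distribˡ-Σ n x f) (Σ-cong n (λ i → *-comm _ _)))

  Σ-head : ∀ n f → Σ (suc n) f ≈ f 0 + Σ n (λ i → f (suc i))
  Σ-head zero    f = trans (+-identityˡ _) (sym (+-identityʳ _))
  Σ-head (suc n) f = trans (+-congʳ (Σ-head n f)) (+-assoc _ _ _)

  Σ-split : ∀ m n f → Σ (m ℕ.+ n) f ≈ Σ m f + Σ n (λ i → f (m ℕ.+ i))
  Σ-split m zero    f = trans (reflexive (P.cong (λ k → Σ k f) (ℕP.+-identityʳ m))) (sym (+-identityʳ _))
  Σ-split m (suc n) f = begin
    Σ (m ℕ.+ suc n) f                               ≡⟨ P.cong (λ k → Σ k f) (ℕP.+-suc m n) ⟩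
    Σ (m ℕ.+ n) f + f (m ℕ.+ n)                     ≈⟨ +-congʳ (Σ-split m n f) ⟩
    (Σ m f + Σ n (λ i → f (m ℕ.+ i))) + f (m ℕ.+ n) ≈⟨ +-assoc _ _ _ ⟩
    Σ m f + Σ (suc n) (λ i → f (m ℕ.+ i))           ∎

  Σ-swap : ∀ m n (f : ℕ → ℕ → Carrier) →
           Σ m (λ i → Σ n (λ j → f i j)) ≈ Σ n (λ j → Σ m (λ i → f i j))
  Σ-swap zero    n f = sym (Σ-zero n (λ _ _ → refl))
  Σ-swap (suc m) n f = trans (+-congʳ (Σ-swap m n f)) (sym (Σ-+ n _ _))

  Σ-reverse : ∀ n f → Σ n f ≈ Σ n (λ i → f (n ∸ suc i))
  Σ-reverse zero    f = refl
  Σ-reverse (suc n) f = begin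
    Σ n f + f n                                ≈⟨ +-comm _ _ ⟩
    f n + Σ n f                                ≈⟨ +-congˡ (Σ-reverse n f) ⟩
    f n + Σ n (λ i → f (suc n ∸ suc (suc i)))  ≈⟨ sym (Σ-head n _) ⟩
    Σ (suc n) (λ i → f (suc n ∸ suc i))        ∎

  -- Both sides sum h a b over the triangle a + b ≤ m, by rows and by antidiagonals.
  Σ-triangle : ∀ m (h : ℕ → ℕ → Carrier) →
    Σ (suc m) (λ a → Σ (suc (m ∸ a)) (h a)) ≈ Σ (suc m) (λ c → Σ (suc c) (λ a → h a (c ∸ a)))
  Σ-triangle zero    h = refl
  Σ-triangle (suc m) h = begin
    Σ (suc m) (λ a → Σ (suc (suc m ∸ a)) (h a)) + Σ (suc (m ∸ m)) (h (suc m))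
      ≈⟨ +-cong (Σ-cong< (suc m) (λ a a≤m → reflexive (P.cong (λ k → Σ (suc k) (h a)) (suc-∸ a≤m))))
                (reflexive (P.cong (λ k → Σ (suc k) (h (suc m))) (ℕP.n∸n≡0 m))) ⟩
    Σ (suc m) (λ a → Σ (suc (m ∸ a)) (h a) + h a (suc (m ∸ a))) + Σ 1 (h (suc m))
      ≈⟨ +-congʳ (Σ-+ (suc m) _ _) ⟩
    (Σ (suc m) (λ a → Σ (suc (m ∸ a)) (h a)) + Σ (suc m) (λ a → h a (suc (m ∸ a)))) + Σ 1 (h (suc m))
      ≈⟨ +-assoc _ _ _ ⟩
    Σ (suc m) (λ a → Σ (suc (m ∸ a)) (h a)) + (Σ (suc m) (λ a → h a (suc (m ∸ a))) + Σ 1 (h (suc m)))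
      ≈⟨ +-cong (Σ-triangle m h)
                (+-cong (Σ-cong< (suc m) (λ a a≤m → reflexive (P.cong (h a) (P.sym (suc-∸ a≤m)))))
                        (trans (+-identityˡ _) (reflexive (P.cong (h (suc m)) (P.sym (ℕP.n∸n≡0 m)))))) ⟩
    Σ (suc m) (λ c → Σ (suc c) (λ a → h a (c ∸ a))) + Σ (suc (suc m)) (λ a → h a (suc m ∸ a)) ∎
    where
    suc-∸ : ∀ {a} → a < suc m → suc m ∸ a ≡ suc (m ∸ a)
    suc-∸ a<1+m = ℕP.+-∸-assoc 1 (ℕP.≤-pred a<1+m)

  conv : (ℕ → Carrier) → (ℕ → Carrier) → ℕ → Carrier
  conv f g m = Σ (suc m) (λ a → f a * g (m ∸ a))

  conv-cong : ∀ {f f′ g g′} → (∀ i → f i ≈ f′ i) → (∀ i → g i ≈ g′ i) →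
              ∀ m → conv f g m ≈ conv f′ g′ m
  conv-cong f≈f′ g≈g′ m = Σ-cong (suc m) (λ a → *-cong (f≈f′ a) (g≈g′ (m ∸ a)))

  conv-comm : ∀ f g m → conv f g m ≈ conv g f m
  conv-comm f g m = begin
    Σ (suc m) (λ a → f a * g (m ∸ a))              ≈⟨ Σ-reverse (suc m) _ ⟩
    Σ (suc m) (λ a → f (m ∸ a) * g (m ∸ (m ∸ a))) ≈⟨ Σ-cong< (suc m) flip ⟩
    Σ (suc m) (λ a → g a * f (m ∸ a))              ∎
    where
    flip : ∀ a → a < suc m → f (m ∸ a) * g (m ∸ (m ∸ a)) ≈ g a * f (m ∸ a)
    flip a a≤m = trans (*-comm _ _)
      (reflexive (P.cong (λ k → g k * f (m ∸ a)) (ℕP.m∸[m∸n]≡n (ℕP.≤-pred a≤m))))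

  conv-assoc : ∀ f g h m → conv (conv f g) h m ≈ conv f (conv g h) m
  conv-assoc f g h m = begin
    Σ (suc m) (λ c → Σ (suc c) (λ a → f a * g (c ∸ a)) * h (m ∸ c))
      ≈⟨ Σ-cong (suc m) (λ c → *-distribʳ-Σ (suc c) _ _) ⟩
    Σ (suc m) (λ c → Σ (suc c) (λ a → (f a * g (c ∸ a)) * h (m ∸ c)))
      ≈⟨ Σ-cong (suc m) (λ c → Σ-cong< (suc c) (λ a a≤c → trans (*-assoc _ _ _)
           (*-congˡ (*-congˡ (reflexive (P.cong h (∸-split (ℕP.≤-pred a≤c)))))))) ⟩
    Σ (suc m) (λ c → Σ (suc c) (λ a → f a * (g (c ∸ a) * h (m ∸ a ∸ (c ∸ a)))))
      ≈⟨ sym (Σ-triangle m (λ a b → f a * (g b * h (m ∸ a ∸ b)))) ⟩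
    Σ (suc m) (λ a → Σ (suc (m ∸ a)) (λ b → f a * (g b * h (m ∸ a ∸ b))))
      ≈⟨ Σ-cong (suc m) (λ a → sym (*-distribˡ-Σ (suc (m ∸ a)) _ _)) ⟩
    Σ (suc m) (λ a → f a * Σ (suc (m ∸ a)) (λ b → g b * h (m ∸ a ∸ b))) ∎
    where
    ∸-split : ∀ {a c} → a ≤ c → m ∸ c ≡ m ∸ a ∸ (c ∸ a)
    ∸-split {a} {c} a≤c = P.trans (P.cong (m ∸_) (P.trans (P.sym (ℕP.m∸n+n≡m a≤c)) (ℕP.+-comm (c ∸ a) a)))
                                     (P.sym (ℕP.∸-+-assoc m a (c ∸ a)))

  conv-distribˡ : ∀ f g h m → conv f (λ i → g i + h i) m ≈ conv f g m + conv f h m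
  conv-distribˡ f g h m = trans (Σ-cong (suc m) (λ a → distribˡ _ _ _)) (Σ-+ (suc m) _ _)

  δ₀ : ℕ → Carrier
  δ₀ zero    = 1#
  δ₀ (suc _) = 0#

  conv-identityˡ : ∀ f m → conv δ₀ f m ≈ f m
  conv-identityˡ f m = begin
    Σ (suc m) (λ a → δ₀ a * f (m ∸ a))              ≈⟨ Σ-head m _ ⟩
    1# * f m + Σ m (λ i → 0# * f (m ∸ suc i))       ≈⟨ +-cong (*-identityˡ _) (Σ-zero m (λ i _ → zeroˡ _)) ⟩
    f m + 0#                                        ≈⟨ +-identityʳ _ ⟩
    f m                                             ∎

  Σ-update : ∀ n s → s < n → ∀ {f g a b} → (∀ d → d ≢ s → f d ≈ g d) → f s + a ≈ g s + b →
             Σ n f + a ≈ Σ n g + b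
  Σ-update (suc n) s s<1+n {f} {g} {a} {b} off at with ℕP.m≤n⇒m<n∨m≡n (ℕP.≤-pred s<1+n)
  ... | inj₁ s<n = begin
    (Σ n f + f n) + a ≈⟨ swap-last _ _ _ ⟩
    (Σ n f + a) + f n ≈⟨ +-cong (Σ-update n s s<n off at) (off n (λ n≡s → ℕP.<-irrefl (P.sym n≡s) s<n)) ⟩
    (Σ n g + b) + g n ≈⟨ swap-last _ _ _ ⟩
    (Σ n g + g n) + b ∎
    where
    swap-last : ∀ x y z → (x + y) + z ≈ (x + z) + y
    swap-last x y z = trans (+-assoc x y z) (trans (+-congˡ (+-comm y z)) (sym (+-assoc x z y)))
  ... | inj₂ P.refl = begin
    (Σ n f + f n) + a ≈⟨ +-assoc _ _ _ ⟩
    Σ n f + (f n + a) ≈⟨ +-cong (Σ-cong< n (λ d d<n → off d (λ d≡n → ℕP.<-irrefl d≡n d<n))) at ⟩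
    Σ n g + (g n + b) ≈⟨ sym (+-assoc _ _ _) ⟩
    (Σ n g + g n) + b ∎


module FiniteSumRing {c ℓ} (R : CommutativeRing c ℓ) where

  open import Data.Nat using (zero; suc)
  open CommutativeRing R
  open import Algebra.Properties.Ring ring using (-0#≈0#; -‿+-comm)
  open FiniteSum commutativeSemiring public

  -‿Σ : ∀ n f → - Σ n f ≈ Σ n (λ i → - f i)
  -‿Σ zero    f = -0#≈0#
  -‿Σ (suc n) f = trans (sym (-‿+-comm _ _)) (+-congʳ (-‿Σ n f))


module PowerSeries {c ℓ} (R : CommutativeRing c ℓ) where

  open import Data.Nat using (ℕ)
  open import Data.Product using (_,_)
  open CommutativeRing R
  open FiniteSum commutativeSemiring using (conv; conv-cong; conv-comm; conv-assoc; conv-distribˡ; δ₀; conv-identityˡ)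

  conv-identityʳ : ∀ f i → conv f δ₀ i ≈ f i
  conv-identityʳ f i = trans (conv-comm f δ₀ i) (conv-identityˡ f i)

  conv-distribʳ : ∀ f g h i → conv (λ k → g k + h k) f i ≈ conv g f i + conv h f i
  conv-distribʳ f g h i =
    trans (conv-comm _ f i) (trans (conv-distribˡ f g h i) (+-cong (conv-comm f g i) (conv-comm f h i)))

  seriesRing : CommutativeRing c ℓ
  seriesRing = record
    { Carrier = ℕ → Carrier
    ; _≈_ = λ f g → ∀ i → f i ≈ g i
    ; _+_ = λ f g i → f i + g i
    ; _*_ = conv
    ; -_ = λ f i → - f i
    ; 0# = λ _ → 0#
    ; 1# = δ₀
    ; isCommutativeRing = record
      { isRing = record
        { +-isAbelianGroup = record
          { isGroup = record
            { isMonoid = record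
              { isSemigroup = record
                { isMagma = record
                  { isEquivalence = record
                    { refl = λ i → refl ; sym = λ p i → sym (p i) ; trans = λ p q i → trans (p i) (q i) }
                  ; ∙-cong = λ p q i → +-cong (p i) (q i) }
                ; assoc = λ f g h i → +-assoc (f i) (g i) (h i) }
              ; identity = (λ f i → +-identityˡ (f i)) , (λ f i → +-identityʳ (f i)) }
            ; inverse = (λ f i → -‿inverseˡ (f i)) , (λ f i → -‿inverseʳ (f i))
            ; ⁻¹-cong = λ p i → -‿cong (p i) }
          ; comm = λ f g i → +-comm (f i) (g i) }
        ; *-cong = conv-cong
        ; *-assoc = conv-assoc
        ; *-identity = conv-identityˡ , conv-identityʳ
        ; distrib = conv-distribˡ , conv-distribʳ
        }
      ; *-comm = conv-comm
      }
    }


module RationalSum where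

  open import Defs using (Σ<; δ; shift)
  open import Data.Nat as ℕ using (ℕ; zero; suc; _∸_; _<_)
  open import Data.Rational as ℚ using (ℚ; 0ℚ; _+_; _-_; _*_; -_)
  import Data.Rational.Properties as ℚP
  open import Algebra.Bundles using (CommutativeRing)
  open import Algebra.Solver.Ring.AlmostCommutativeRing using (fromCommutativeRing)
  import Algebra.Solver.Ring.Simple
  open import Relation.Binary.PropositionalEquality using (_≡_; refl; sym; trans; cong; cong₂)

  ℚ-ring : CommutativeRing _ _
  ℚ-ring = ℚP.+-*-commutativeRing

  module ℚ-Solver = Algebra.Solver.Ring.Simple (fromCommutativeRing ℚ-ring) ℚ._≟_

  module ΣQ = FiniteSumRing ℚ-ring

  Σ<≡Σ : ∀ n f → Σ< n f ≡ ΣQ.Σ n f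
  Σ<≡Σ zero    f = refl
  Σ<≡Σ (suc n) f = cong (_+ f n) (Σ<≡Σ n f)

  Σ<-cong< : ∀ n {f g : ℕ → ℚ} → (∀ i → i < n → f i ≡ g i) → Σ< n f ≡ Σ< n g
  Σ<-cong< n {f} {g} h = trans (Σ<≡Σ n f) (trans (ΣQ.Σ-cong< n h) (sym (Σ<≡Σ n g)))

  Σ<-cong : ∀ n {f g : ℕ → ℚ} → (∀ i → f i ≡ g i) → Σ< n f ≡ Σ< n g
  Σ<-cong n h = Σ<-cong< n (λ i _ → h i)

  Σ<-zero : ∀ n {f} → (∀ i → i < n → f i ≡ 0ℚ) → Σ< n f ≡ 0ℚ
  Σ<-zero n {f} h = trans (Σ<≡Σ n f) (ΣQ.Σ-zero n h)

  Σ<-head : ∀ n f → Σ< (suc n) f ≡ f 0 + Σ< n (λ i → f (suc i))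
  Σ<-head n f = trans (Σ<≡Σ (suc n) f) (trans (ΣQ.Σ-head n f) (cong (f 0 +_) (sym (Σ<≡Σ n _))))

  Σ<-+ : ∀ n f g → Σ< n (λ i → f i + g i) ≡ Σ< n f + Σ< n g
  Σ<-+ n f g = trans (Σ<≡Σ n _) (trans (ΣQ.Σ-+ n f g) (sym (cong₂ _+_ (Σ<≡Σ n f) (Σ<≡Σ n g))))

  -‿Σ< : ∀ n f → - Σ< n f ≡ Σ< n (λ i → - f i)
  -‿Σ< n f = trans (cong -_ (Σ<≡Σ n f)) (trans (ΣQ.-‿Σ n f) (sym (Σ<≡Σ n _)))

  Σ<-sub : ∀ n f g → Σ< n (λ i → f i - g i) ≡ Σ< n f - Σ< n g
  Σ<-sub n f g = trans (Σ<-+ n f (λ i → - g i)) (cong (Σ< n f +_) (sym (-‿Σ< n g)))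

  *-distribˡ-Σ< : ∀ n x f → x * Σ< n f ≡ Σ< n (λ i → x * f i)
  *-distribˡ-Σ< n x f = trans (cong (x *_) (Σ<≡Σ n f)) (trans (ΣQ.*-distribˡ-Σ n x f) (sym (Σ<≡Σ n _)))

  Σ<-split : ∀ m n f → Σ< (m ℕ.+ n) f ≡ Σ< m f + Σ< n (λ i → f (m ℕ.+ i))
  Σ<-split m n f = trans (Σ<≡Σ (m ℕ.+ n) f) (trans (ΣQ.Σ-split m n f) (sym (cong₂ _+_ (Σ<≡Σ m f) (Σ<≡Σ n _))))

  Σ<-swap : ∀ m n (f : ℕ → ℕ → ℚ) → Σ< m (λ i → Σ< n (f i)) ≡ Σ< n (λ j → Σ< m (λ i → f i j))
  Σ<-swap m n f = trans (Σ<-cong m (λ i → Σ<≡Σ n (f i))) (trans (Σ<≡Σ m _)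
    (trans (ΣQ.Σ-swap m n f) (trans (sym (Σ<≡Σ n _)) (Σ<-cong n (λ j → sym (Σ<≡Σ m _))))))

  Σ<-reverse : ∀ n f → Σ< n f ≡ Σ< n (λ i → f (n ∸ suc i))
  Σ<-reverse n f = trans (Σ<≡Σ n f) (trans (ΣQ.Σ-reverse n f) (sym (Σ<≡Σ n _)))

  Σ<-δ₀ : ∀ n (g : ℕ → ℚ) → Σ< (suc n) (λ b → δ 0 b * g b) ≡ g 0
  Σ<-δ₀ n g = trans (Σ<-head n (λ b → δ 0 b * g b))
    (trans (cong₂ _+_ (ℚP.*-identityˡ (g 0)) (Σ<-zero n (λ i _ → ℚP.*-zeroˡ (g (suc i)))))
           (ℚP.+-identityʳ (g 0)))

  Σ<-δ₁ : ∀ n (g : ℕ → ℚ) → Σ< (suc n) (λ b → δ 1 b * g b) ≡ shift (λ _ → g 1) n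
  Σ<-δ₁ zero    g = trans (ℚP.+-identityˡ (0ℚ * g 0)) (ℚP.*-zeroˡ (g 0))
  Σ<-δ₁ (suc n) g = trans (Σ<-head (suc n) (λ b → δ 1 b * g b))
    (trans (cong₂ _+_ (ℚP.*-zeroˡ (g 0)) (Σ<-δ₀ n (λ i → g (suc i)))) (ℚP.+-identityˡ (g 1)))


module Bivariate where

  open import Defs
  open import Data.Nat as ℕ using (ℕ; zero; suc; _∸_)
  open import Data.Rational as ℚ using (ℚ; 0ℚ; 1ℚ; _+_; _*_; -_)
  import Data.Rational.Properties as ℚP
  open import Data.Product using (_,_)
  open import Data.Maybe using (Maybe; just; nothing)
  open import Relation.Nullary using (yes; no)
  open import Algebra.Bundles using (CommutativeRing)
  open import Algebra.Solver.Ring.AlmostCommutativeRing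
    using (fromCommutativeRing; _-Raw-AlmostCommutative⟶_)
  import Algebra.Solver.Ring
  open import Relation.Binary.PropositionalEquality as P using (_≡_; refl; sym; trans; cong)
  open RationalSum

  -- Reading f m j as [x^m y^j] f, P2 is the ring of power series in x over power series in y,
  -- and ⊗ is its product (⊗≋S2-*).
  private
    module S1 = PowerSeries ℚ-ring
    module ΣS1 = FiniteSum (CommutativeRing.commutativeSemiring S1.seriesRing)
    module S2 = CommutativeRing (PowerSeries.seriesRing S1.seriesRing)

  ΣS1≡Σ< : ∀ n F j → ΣS1.Σ n F j ≡ Σ< n (λ a → F a j)
  ΣS1≡Σ< zero    F j = refl
  ΣS1≡Σ< (suc n) F j = cong (_+ F n j) (ΣS1≡Σ< n F j)

  infix 4 _≋_
  _≋_ : P2 → P2 → Set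
  f ≋ g = ∀ m j → f m j ≡ g m j

  ⊗≋S2-* : ∀ f g → (f ⊗ g) ≋ (f S2.* g)
  ⊗≋S2-* f g m j = sym (trans (ΣS1≡Σ< (suc m) _ j) (Σ<-cong (suc m) (λ a → sym (Σ<≡Σ (suc j) _))))

  cst-1≋S2-1 : cst 1ℚ ≋ S2.1#
  cst-1≋S2-1 zero    zero    = refl
  cst-1≋S2-1 zero    (suc j) = refl
  cst-1≋S2-1 (suc m) zero    = refl
  cst-1≋S2-1 (suc m) (suc j) = refl

  P2-ring : CommutativeRing _ _
  P2-ring = record
    { Carrier = P2
    ; _≈_ = _≋_
    ; _+_ = _⊕_
    ; _*_ = _⊗_
    ; -_ = λ f m j → - f m j
    ; 0# = λ _ _ → 0ℚ
    ; 1# = cst 1ℚ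
    ; isCommutativeRing = record
      { isRing = record
        { +-isAbelianGroup = S2.+-isAbelianGroup
        ; *-cong = λ {f} {f′} {g} {g′} f≋f′ g≋g′ →
            S2.trans (⊗≋S2-* f g) (S2.trans (S2.*-cong f≋f′ g≋g′) (S2.sym (⊗≋S2-* f′ g′)))
        ; *-assoc = λ f g h → begin
            (f ⊗ g) ⊗ h       ≈⟨ ⊗≋S2-* (f ⊗ g) h ⟩
            (f ⊗ g) S2.* h    ≈⟨ S2.*-congʳ {h} (⊗≋S2-* f g) ⟩
            (f S2.* g) S2.* h ≈⟨ S2.*-assoc f g h ⟩
            f S2.* (g S2.* h) ≈⟨ S2.*-congˡ {f} (S2.sym (⊗≋S2-* g h)) ⟩
            f S2.* (g ⊗ h)    ≈⟨ S2.sym (⊗≋S2-* f (g ⊗ h)) ⟩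
            f ⊗ (g ⊗ h)       ∎
        ; *-identity =
            (λ f → S2.trans (⊗≋S2-* (cst 1ℚ) f) (S2.trans (S2.*-congʳ {f} cst-1≋S2-1) (S2.*-identityˡ f))) ,
            (λ f → S2.trans (⊗≋S2-* f (cst 1ℚ)) (S2.trans (S2.*-congˡ {f} cst-1≋S2-1) (S2.*-identityʳ f)))
        ; distrib =
            (λ f g h → S2.trans (⊗≋S2-* f (g ⊕ h))
              (S2.trans (S2.distribˡ f g h) (S2.sym (S2.+-cong (⊗≋S2-* f g) (⊗≋S2-* f h))))) ,
            (λ f g h → S2.trans (⊗≋S2-* (g ⊕ h) f)
              (S2.trans (S2.distribʳ f g h) (S2.sym (S2.+-cong (⊗≋S2-* g f) (⊗≋S2-* h f)))))
        }
      ; *-comm = λ f g → S2.trans (⊗≋S2-* f g) (S2.trans (S2.*-comm f g) (S2.sym (⊗≋S2-* g f)))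
      }
    }
    where open import Relation.Binary.Reasoning.Setoid S2.setoid

  module ΣP2 = FiniteSumRing P2-ring

  ΣP2≡Σ< : ∀ n F m j → ΣP2.Σ n F m j ≡ Σ< n (λ l → F l m j)
  ΣP2≡Σ< zero    F m j = refl
  ΣP2≡Σ< (suc n) F m j = cong (_+ F n m j) (ΣP2≡Σ< n F m j)

  shiftX shiftY : P2 → P2
  shiftX f zero    j = 0ℚ
  shiftX f (suc m) j = f m j
  shiftY f m zero    = 0ℚ
  shiftY f m (suc j) = f m j

  X⊗≋shiftX : ∀ f → (X ⊗ f) ≋ shiftX f
  X⊗≋shiftX f m j = begin
    Σ< (suc m) (λ a → Σ< (suc j) (λ b → (δ 1 a * δ 0 b) * f (m ∸ a) (j ∸ b)))
      ≡⟨ Σ<-cong (suc m) (λ a → trans (Σ<-cong (suc j) (λ b → ℚP.*-assoc (δ 1 a) (δ 0 b) _))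
                                      (sym (*-distribˡ-Σ< (suc j) (δ 1 a) _))) ⟩
    Σ< (suc m) (λ a → δ 1 a * Σ< (suc j) (λ b → δ 0 b * f (m ∸ a) (j ∸ b)))
      ≡⟨ Σ<-cong (suc m) (λ a → cong (δ 1 a *_) (Σ<-δ₀ j (λ b → f (m ∸ a) (j ∸ b)))) ⟩
    Σ< (suc m) (λ a → δ 1 a * f (m ∸ a) j)
      ≡⟨ Σ<-δ₁ m (λ a → f (m ∸ a) j) ⟩
    shift (λ _ → f (m ∸ 1) j) m
      ≡⟨ shift-pred m ⟩
    shiftX f m j ∎
    where
    open P.≡-Reasoning
    shift-pred : ∀ m → shift (λ _ → f (m ∸ 1) j) m ≡ shiftX f m j
    shift-pred zero    = refl
    shift-pred (suc m) = refl

  Y⊗≋shiftY : ∀ f → (Y ⊗ f) ≋ shiftY f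
  Y⊗≋shiftY f m j = begin
    Σ< (suc m) (λ a → Σ< (suc j) (λ b → (δ 0 a * δ 1 b) * f (m ∸ a) (j ∸ b)))
      ≡⟨ Σ<-cong (suc m) (λ a → trans (Σ<-cong (suc j) (λ b → ℚP.*-assoc (δ 0 a) (δ 1 b) _))
                                      (sym (*-distribˡ-Σ< (suc j) (δ 0 a) _))) ⟩
    Σ< (suc m) (λ a → δ 0 a * Σ< (suc j) (λ b → δ 1 b * f (m ∸ a) (j ∸ b)))
      ≡⟨ Σ<-δ₀ m (λ a → Σ< (suc j) (λ b → δ 1 b * f (m ∸ a) (j ∸ b))) ⟩
    Σ< (suc j) (λ b → δ 1 b * f m (j ∸ b))
      ≡⟨ Σ<-δ₁ j (λ b → f m (j ∸ b)) ⟩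
    shift (λ _ → f m (j ∸ 1)) j
      ≡⟨ shift-pred j ⟩
    shiftY f m j ∎
    where
    open P.≡-Reasoning
    shift-pred : ∀ j → shift (λ _ → f m (j ∸ 1)) j ≡ shiftY f m j
    shift-pred zero    = refl
    shift-pred (suc j) = refl

  cst⊗≋scale : ∀ c f → (cst c ⊗ f) ≋ (λ m j → c * f m j)
  cst⊗≋scale c f m j = begin
    Σ< (suc m) (λ a → Σ< (suc j) (λ b → (c * δ 0 a * δ 0 b) * f (m ∸ a) (j ∸ b)))
      ≡⟨ Σ<-cong (suc m) (λ a → trans (Σ<-cong (suc j) (λ b → rearrange c (δ 0 a) (δ 0 b) _))
                                      (sym (*-distribˡ-Σ< (suc j) (δ 0 a) _))) ⟩
    Σ< (suc m) (λ a → δ 0 a * Σ< (suc j) (λ b → δ 0 b * (c * f (m ∸ a) (j ∸ b))))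
      ≡⟨ Σ<-δ₀ m (λ a → Σ< (suc j) (λ b → δ 0 b * (c * f (m ∸ a) (j ∸ b)))) ⟩
    Σ< (suc j) (λ b → δ 0 b * (c * f m (j ∸ b)))
      ≡⟨ Σ<-δ₀ j (λ b → c * f m (j ∸ b)) ⟩
    c * f m j ∎
    where
    open P.≡-Reasoning
    open ℚ-Solver using (solve; _:=_; _:*_)
    rearrange : ∀ c x y z → (c * x * y) * z ≡ x * (y * (c * z))
    rearrange = solve 4 (λ c x y z → (c :* x :* y) :* z := x :* (y :* (c :* z))) refl

  cst-+ : ∀ a b → cst (a + b) ≋ (cst a ⊕ cst b)
  cst-+ a b m j = trans (cong (_* δ 0 j) (ℚP.*-distribʳ-+ (δ 0 m) a b)) (ℚP.*-distribʳ-+ (δ 0 j) (a * δ 0 m) (b * δ 0 m))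

  cst-neg : ∀ a → cst (- a) ≋ (λ m j → - cst a m j)
  cst-neg a m j = trans (cong (_* δ 0 j) (sym (ℚP.neg-distribˡ-* a (δ 0 m)))) (sym (ℚP.neg-distribˡ-* (a * δ 0 m) (δ 0 j)))

  cst-* : ∀ a b → cst (a * b) ≋ (cst a ⊗ cst b)
  cst-* a b m j = trans (trans (cong (_* δ 0 j) (ℚP.*-assoc a b (δ 0 m))) (ℚP.*-assoc a (b * δ 0 m) (δ 0 j)))
                        (sym (cst⊗≋scale a (cst b) m j))

  cst-0 : cst 0ℚ ≋ (λ _ _ → 0ℚ)
  cst-0 m j = trans (cong (_* δ 0 j) (ℚP.*-zeroˡ (δ 0 m))) (ℚP.*-zeroˡ (δ 0 j))

  cst-cong : ∀ {a b} → a ≡ b → cst a ≋ cst b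
  cst-cong a≡b m j = cong (λ q → cst q m j) a≡b

  private
    cst-morphism : CommutativeRing.rawRing ℚ-ring -Raw-AlmostCommutative⟶ fromCommutativeRing P2-ring
    cst-morphism = record
      { ⟦_⟧ = cst ; +-homo = cst-+ ; *-homo = cst-* ; -‿homo = cst-neg ; 0-homo = cst-0 ; 1-homo = λ m j → refl }

    cst≟ : ∀ a b → Maybe (cst a ≋ cst b)
    cst≟ a b with a ℚ.≟ b
    ... | yes a≡b = just (cst-cong a≡b)
    ... | no  _   = nothing

  module P2-Solver = Algebra.Solver.Ring (CommutativeRing.rawRing ℚ-ring) (fromCommutativeRing P2-ring) cst-morphism cst≟


module HomogenisedChebyshev where

  open import Defs
  open Bivariate
  open import Data.Nat as ℕ using (ℕ; zero; suc; _∸_; _≤_; _<_; z≤n; s≤s)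
  import Data.Nat.Properties as ℕP
  open import Data.Nat.DivMod using (_/_; m/n≡1+[m∸n]/n)
  open import Data.Rational as ℚ using (ℚ; 0ℚ; ½)
  open import Data.Product using (_×_; _,_)
  open import Data.Sum using (_⊎_; inj₁; inj₂)
  open import Algebra.Bundles using (CommutativeRing)
  import Relation.Binary.PropositionalEquality as P
  open P using (_≡_)

  open CommutativeRing P2-ring
  open import Relation.Binary.Reasoning.Setoid setoid
  open P2-Solver using (solve; _:=_; _:*_; _:-_; con)
  open ΣP2 using (Σ; Σ-cong; Σ-cong<; Σ-+; Σ-head; *-distribˡ-Σ; -‿Σ)

  [2+i]/2≡1+i/2 : ∀ i → suc (suc i) / 2 ≡ suc (i / 2)
  [2+i]/2≡1+i/2 i = m/n≡1+[m∸n]/n {suc (suc i)} {2} (s≤s (s≤s z≤n))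

  /2-parity : ∀ i → (suc i / 2 ≡ i / 2 × i / 2 ℕ.+ i / 2 ≡ i)
                  ⊎ (suc i / 2 ≡ suc (i / 2) × suc (i / 2 ℕ.+ i / 2) ≡ i)
  /2-parity zero          = inj₁ (P.refl , P.refl)
  /2-parity (suc zero)    = inj₂ (P.refl , P.refl)
  /2-parity (suc (suc i)) with /2-parity i
  ... | inj₁ (p , q) = inj₁ (P.trans ([2+i]/2≡1+i/2 (suc i)) (P.trans (P.cong suc p) (P.sym ([2+i]/2≡1+i/2 i))) ,
                             P.trans (P.cong (λ k → k ℕ.+ k) ([2+i]/2≡1+i/2 i))
                                     (P.trans (P.cong suc (ℕP.+-suc (i / 2) (i / 2))) (P.cong (λ k → suc (suc k)) q)))
  ... | inj₂ (p , q) = inj₂ (P.trans ([2+i]/2≡1+i/2 (suc i)) (P.trans (P.cong suc p) (P.cong suc (P.sym ([2+i]/2≡1+i/2 i)))) ,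
                             P.trans (P.cong (λ k → suc (k ℕ.+ k)) ([2+i]/2≡1+i/2 i))
                                     (P.trans (P.cong (λ k → suc (suc k)) (ℕP.+-suc (i / 2) (i / 2))) (P.cong (λ k → suc (suc k)) q)))

  halfS : P2
  halfS = cst ½ ⊗ S

  hTerm : (ℕ → ℕ → ℚ) → ℕ → ℕ → P2
  hTerm c i l = cst (c i (i ∸ (l ℕ.+ l))) ⊗ (pow halfS (i ∸ (l ℕ.+ l)) ⊗ pow Z l)

  hCheb : (ℕ → ℕ → ℚ) → ℕ → P2
  hCheb c i = Σ (suc (i / 2)) (hTerm c i)

  homog≈hCheb : ∀ c i → homog c i ≈ hCheb c i
  homog≈hCheb c i m j = P.sym (ΣP2≡Σ< (suc (i / 2)) (hTerm c i) m j)

  module _ (c : ℕ → ℕ → ℚ)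
           (c-degree : ∀ i e → i < e → c i e ≡ 0ℚ)
           (c-rec : ∀ i e → c (suc (suc i)) e ≡ two ℚ.* shift (c (suc i)) e ℚ.+ ℚ.- c i e) where

    twiceTerm lowerTerm : ℕ → ℕ → P2
    twiceTerm i l = cst (two ℚ.* shift (c (suc i)) (suc (suc i) ∸ (l ℕ.+ l))) ⊗ (pow halfS (suc (suc i) ∸ (l ℕ.+ l)) ⊗ pow Z l)
    lowerTerm i l = cst (c i (suc (suc i) ∸ (l ℕ.+ l))) ⊗ (pow halfS (suc (suc i) ∸ (l ℕ.+ l)) ⊗ pow Z l)

    hTerm-split : ∀ i l → hTerm c (suc (suc i)) l ≈ twiceTerm i l - lowerTerm i l
    hTerm-split i l = begin
      cst (c (suc (suc i)) e) * q                              ≈⟨ *-congʳ {q} (cst-cong (c-rec i e)) ⟩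
      cst (two ℚ.* shift (c (suc i)) e ℚ.+ ℚ.- c i e) * q     ≈⟨ *-congʳ {q} (trans (cst-+ a (ℚ.- c i e)) (+-congˡ {cst a} (cst-neg (c i e)))) ⟩
      (cst a + - cst (c i e)) * q ≈⟨ solve 3 (λ a b q → (a :- b) :* q := a :* q :- b :* q) refl (cst a) (cst (c i e)) q ⟩
      twiceTerm i l - lowerTerm i l ∎
      where e = suc (suc i) ∸ (l ℕ.+ l)
            a = two ℚ.* shift (c (suc i)) e
            q = pow halfS e ⊗ pow Z l

    lowerTerm-suc : ∀ i l → lowerTerm i (suc l) ≈ Z * hTerm c i l
    lowerTerm-suc i l = begin
      lowerTerm i (suc l)                       ≈⟨ (λ m j → P.cong (λ e → (cst (c i e) ⊗ (pow halfS e ⊗ pow Z (suc l))) m j)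
                                                                   (P.cong (suc i ∸_) (ℕP.+-suc l l))) ⟩
      cst (c i e) * (pow halfS e * (Z * pow Z l)) ≈⟨ solve 4 (λ x p z w → x :* (p :* (z :* w)) := z :* (x :* (p :* w)))
                                                             refl (cst (c i e)) (pow halfS e) Z (pow Z l) ⟩
      Z * hTerm c i l                           ∎
      where e = i ∸ (l ℕ.+ l)

    lowerTerm-zero : ∀ i → lowerTerm i 0 ≈ 0#
    lowerTerm-zero i = trans (*-congʳ {q} (trans (cst-cong (c-degree i (suc (suc i)) (s≤s (ℕP.n≤1+n i)))) cst-0)) (zeroˡ q)
      where q = pow halfS (suc (suc i)) ⊗ pow Z 0

    Σ-lowerTerm : ∀ i → Σ (suc (suc (i / 2))) (lowerTerm i) ≈ Z * hCheb c i
    Σ-lowerTerm i = begin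
      Σ (suc (suc (i / 2))) (lowerTerm i)                     ≈⟨ Σ-head (suc (i / 2)) (lowerTerm i) ⟩
      lowerTerm i 0 + Σ (suc (i / 2)) (λ l → lowerTerm i (suc l)) ≈⟨ +-cong (lowerTerm-zero i) (Σ-cong (suc (i / 2)) (lowerTerm-suc i)) ⟩
      0# + Σ (suc (i / 2)) (λ l → Z * hTerm c i l)           ≈⟨ +-identityˡ (Σ (suc (i / 2)) (λ l → Z * hTerm c i l)) ⟩
      Σ (suc (i / 2)) (λ l → Z * hTerm c i l)                ≈⟨ sym (*-distribˡ-Σ (suc (i / 2)) Z (hTerm c i)) ⟩
      Z * hCheb c i                                          ∎

    twiceTerm-low : ∀ i l → l ℕ.+ l ≤ suc i → twiceTerm i l ≈ S * hTerm c (suc i) l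
    twiceTerm-low i l 2l≤1+i = begin
      twiceTerm i l                ≈⟨ (λ m j → P.cong (λ e → (cst (two ℚ.* shift (c (suc i)) e) ⊗ (pow halfS e ⊗ pow Z l)) m j)
                                                      (ℕP.+-∸-assoc 1 2l≤1+i)) ⟩
      cst (two ℚ.* x) * ((cst ½ * S) * pow halfS e * pow Z l) ≈⟨ *-congʳ {(cst ½ * S) * pow halfS e * pow Z l} (cst-* two x) ⟩
      (cst two * cst x) * ((cst ½ * S) * pow halfS e * pow Z l)
        ≈⟨ solve 4 (λ y s p w → (con two :* y) :* ((con ½ :* s) :* p :* w) := s :* (y :* (p :* w))) refl (cst x) S (pow halfS e) (pow Z l) ⟩
      S * hTerm c (suc i) l        ∎
      where e = suc i ∸ (l ℕ.+ l)
            x = c (suc i) e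

    twiceTerm-high : ∀ i l → suc (suc i) ≤ l ℕ.+ l → twiceTerm i l ≈ 0#
    twiceTerm-high i l 2+i≤2l = begin
      twiceTerm i l                         ≈⟨ (λ m j → P.cong (λ e → (cst (two ℚ.* shift (c (suc i)) e) ⊗ (pow halfS e ⊗ pow Z l)) m j)
                                                               (ℕP.m≤n⇒m∸n≡0 2+i≤2l)) ⟩
      cst (two ℚ.* 0ℚ) * (pow halfS 0 * pow Z l) ≈⟨ *-congʳ {pow halfS 0 * pow Z l} cst-0 ⟩
      0# * (pow halfS 0 * pow Z l)          ≈⟨ zeroˡ (pow halfS 0 * pow Z l) ⟩
      0#                                    ∎

    Σ-twiceTerm-low : ∀ i L → (∀ l → l < L → l ℕ.+ l ≤ suc i) → Σ L (twiceTerm i) ≈ S * Σ L (hTerm c (suc i))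
    Σ-twiceTerm-low i L low = trans (Σ-cong< L (λ l l<L → twiceTerm-low i l (low l l<L))) (sym (*-distribˡ-Σ L S (hTerm c (suc i))))

    -- For even i the top summand has 2l = i + 2 and vanishes; for odd i every summand has 2l ≤ i + 1.
    Σ-twiceTerm : ∀ i → Σ (suc (suc (i / 2))) (twiceTerm i) ≈ S * hCheb c (suc i)
    Σ-twiceTerm i with /2-parity i
    ... | inj₁ (half≡ , even) = begin
      Σ (suc p) (twiceTerm i) + twiceTerm i (suc p) ≈⟨ +-cong (Σ-twiceTerm-low i (suc p) low) (twiceTerm-high i (suc p) (ℕP.≤-reflexive top)) ⟩
      S * Σ (suc p) (hTerm c (suc i)) + 0#          ≈⟨ +-identityʳ _ ⟩
      S * Σ (suc p) (hTerm c (suc i))               ≈⟨ reflexive (P.cong (λ n → S * Σ (suc n) (hTerm c (suc i))) (P.sym half≡)) ⟩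
      S * hCheb c (suc i)                           ∎
      where
      p = i / 2
      top : suc (suc i) ≡ suc p ℕ.+ suc p
      top = P.sym (P.trans (P.cong suc (ℕP.+-suc p p)) (P.cong (λ k → suc (suc k)) even))
      low : ∀ l → l < suc p → l ℕ.+ l ≤ suc i
      low l l≤p = ℕP.≤-trans (ℕP.+-mono-≤ (ℕP.≤-pred l≤p) (ℕP.≤-pred l≤p)) (ℕP.≤-trans (ℕP.≤-reflexive even) (ℕP.n≤1+n i))
    ... | inj₂ (half≡ , odd) = begin
      Σ (suc (suc p)) (twiceTerm i)       ≈⟨ Σ-twiceTerm-low i (suc (suc p)) low ⟩
      S * Σ (suc (suc p)) (hTerm c (suc i)) ≈⟨ reflexive (P.cong (λ n → S * Σ (suc n) (hTerm c (suc i))) (P.sym half≡)) ⟩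
      S * hCheb c (suc i)                 ∎
      where
      p = i / 2
      low : ∀ l → l < suc (suc p) → l ℕ.+ l ≤ suc i
      low l l≤1+p = ℕP.≤-trans (ℕP.+-mono-≤ (ℕP.≤-pred l≤1+p) (ℕP.≤-pred l≤1+p))
                               (ℕP.≤-reflexive (P.trans (P.cong suc (ℕP.+-suc p p)) (P.cong suc odd)))

    hCheb-rec : ∀ i → hCheb c (suc (suc i)) ≈ S * hCheb c (suc i) - Z * hCheb c i
    hCheb-rec i = begin
      Σ (suc (suc (suc i) / 2)) (hTerm c (suc (suc i)))        ≈⟨ reflexive (P.cong (λ n → Σ (suc n) (hTerm c (suc (suc i)))) ([2+i]/2≡1+i/2 i)) ⟩
      Σ L (hTerm c (suc (suc i)))                               ≈⟨ Σ-cong L (hTerm-split i) ⟩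
      Σ L (λ l → twiceTerm i l - lowerTerm i l)                 ≈⟨ Σ-+ L (twiceTerm i) (λ l → - lowerTerm i l) ⟩
      Σ L (twiceTerm i) + Σ L (λ l → - lowerTerm i l)           ≈⟨ +-congˡ {Σ L (twiceTerm i)} (sym (-‿Σ L (lowerTerm i))) ⟩
      Σ L (twiceTerm i) - Σ L (lowerTerm i)                     ≈⟨ +-cong (Σ-twiceTerm i) (-‿cong (Σ-lowerTerm i)) ⟩
      S * hCheb c (suc i) - Z * hCheb c i                       ∎
      where L = suc (suc (i / 2))

  chebT-degree : ∀ i e → i < e → chebT i e ≡ 0ℚ
  chebT-degree zero          (suc e)       _ = P.refl
  chebT-degree (suc zero)    (suc zero)    (s≤s ())
  chebT-degree (suc zero)    (suc (suc e)) _ = P.refl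
  chebT-degree (suc (suc i)) (suc e)       (s≤s i<e)
    rewrite chebT-degree (suc i) e i<e | chebT-degree i (suc e) (ℕP.m<n⇒m<1+n (ℕP.<-trans (ℕP.n<1+n i) i<e)) = P.refl

  chebU-degree : ∀ i e → i < e → chebU i e ≡ 0ℚ
  chebU-degree zero          (suc e)       _ = P.refl
  chebU-degree (suc zero)    (suc zero)    (s≤s ())
  chebU-degree (suc zero)    (suc (suc e)) _ = P.refl
  chebU-degree (suc (suc i)) (suc e)       (s≤s i<e)
    rewrite chebU-degree (suc i) e i<e | chebU-degree i (suc e) (ℕP.m<n⇒m<1+n (ℕP.<-trans (ℕP.n<1+n i) i<e)) = P.refl

  hChebT-rec : ∀ i → hCheb chebT (suc (suc i)) ≈ S * hCheb chebT (suc i) - Z * hCheb chebT i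
  hChebT-rec = hCheb-rec chebT chebT-degree (λ i e → P.refl)

  hChebU-rec : ∀ i → hCheb chebU (suc (suc i)) ≈ S * hCheb chebU (suc i) - Z * hCheb chebU i
  hChebU-rec = hCheb-rec chebU chebU-degree (λ i e → P.refl)


module Psi where

  open import Defs
  open Bivariate
  open HomogenisedChebyshev
  open RationalSum using (Σ<-cong; Σ<-cong<; -‿Σ<; module ℚ-Solver)
  open import Data.Nat as ℕ using (ℕ; zero; suc; _∸_)
  import Data.Nat.Properties as ℕP
  open import Data.Rational as ℚ using (ℚ; 0ℚ; 1ℚ; ½)
  import Data.Rational.Properties as ℚP
  open import Algebra.Bundles using (CommutativeRing)
  import Relation.Binary.PropositionalEquality as P
  open P using (_≡_)

  open CommutativeRing P2-ring
  open import Relation.Binary.Reasoning.Setoid setoid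
  open P2-Solver using (solve; _:=_; _:+_; _:*_; _:-_; con)

  numerₕ : ℕ → P2
  numerₕ i = X * ((cst two * Y) * hCheb chebT i + (1# - Y) * hCheb chebU i)

  numer≈numerₕ : ∀ i → numer i ≈ numerₕ i
  numer≈numerₕ i = *-congˡ {X} (+-cong (*-congˡ {cst two * Y} (homog≈hCheb chebT i))
                                       (*-congˡ {1# - Y} (homog≈hCheb chebU i)))

  numerₕ-rec : ∀ i → numerₕ (suc (suc i)) ≈ S * numerₕ (suc i) - Z * numerₕ i
  numerₕ-rec i = begin
    X * ((cst two * Y) * hCheb chebT (suc (suc i)) + (1# - Y) * hCheb chebU (suc (suc i)))
      ≈⟨ *-congˡ {X} (+-cong (*-congˡ {cst two * Y} (hChebT-rec i)) (*-congˡ {1# - Y} (hChebU-rec i))) ⟩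
    X * ((cst two * Y) * (S * T₁ - Z * T₀) + (1# - Y) * (S * U₁ - Z * U₀))
      ≈⟨ solve 8 (λ x y s z t₀ t₁ u₀ u₁ →
                     x :* ((con two :* y) :* (s :* t₁ :- z :* t₀) :+ (con 1ℚ :- y) :* (s :* u₁ :- z :* u₀))
                  := s :* (x :* ((con two :* y) :* t₁ :+ (con 1ℚ :- y) :* u₁))
                     :- z :* (x :* ((con two :* y) :* t₀ :+ (con 1ℚ :- y) :* u₀)))
                 refl X Y S Z T₀ T₁ U₀ U₁ ⟩
    S * numerₕ (suc i) - Z * numerₕ i ∎
    where T₀ = hCheb chebT i
          T₁ = hCheb chebT (suc i)
          U₀ = hCheb chebU i
          U₁ = hCheb chebU (suc i)

  hCheb-0 : ∀ c → c 0 0 ≡ 1ℚ → hCheb c 0 ≈ 1#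
  hCheb-0 c c₀₀≡1 = begin
    0# + cst (c 0 0) * (1# * 1#) ≈⟨ +-congˡ {0#} (*-congʳ {1# * 1#} (cst-cong c₀₀≡1)) ⟩
    0# + 1# * (1# * 1#)          ≈⟨ +-identityˡ (1# * (1# * 1#)) ⟩
    1# * (1# * 1#)               ≈⟨ solve 0 (con 1ℚ :* (con 1ℚ :* con 1ℚ) := con 1ℚ) refl ⟩
    1#                           ∎

  numerₕ-0 : numerₕ 0 ≈ S * X
  numerₕ-0 = begin
    X * ((cst two * Y) * hCheb chebT 0 + (1# - Y) * hCheb chebU 0)
      ≈⟨ *-congˡ {X} (+-cong (*-congˡ {cst two * Y} (hCheb-0 chebT P.refl)) (*-congˡ {1# - Y} (hCheb-0 chebU P.refl))) ⟩
    X * ((cst two * Y) * 1# + (1# - Y) * 1#)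
      ≈⟨ solve 2 (λ x y → x :* ((con two :* y) :* con 1ℚ :+ (con 1ℚ :- y) :* con 1ℚ) := (con 1ℚ :+ y) :* x) refl X Y ⟩
    S * X ∎

  numerₕ-1 : numerₕ 1 ≈ S * X
  numerₕ-1 = begin
    X * ((cst two * Y) * hCheb chebT 1 + (1# - Y) * hCheb chebU 1)
      ≈⟨ *-congˡ {X} (+-cong (*-congˡ {cst two * Y} hChebT-1) (*-congˡ {1# - Y} hChebU-1)) ⟩
    X * ((cst two * Y) * (cst ½ * S) + (1# - Y) * (cst two * (cst ½ * S)))
      ≈⟨ solve 2 (λ x y → x :* ((con two :* y) :* (con ½ :* (con 1ℚ :+ y))
                               :+ (con 1ℚ :- y) :* (con two :* (con ½ :* (con 1ℚ :+ y))))
                        := (con 1ℚ :+ y) :* x) refl X Y ⟩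
    S * X ∎
    where
    hChebT-1 : hCheb chebT 1 ≈ cst ½ * S
    hChebT-1 = trans (+-identityˡ _) (solve 1 (λ s → con 1ℚ :* ((con ½ :* s) :* con 1ℚ :* con 1ℚ) := con ½ :* s) refl S)
    hChebU-1 : hCheb chebU 1 ≈ cst two * (cst ½ * S)
    hChebU-1 = trans (+-identityˡ _) (solve 1 (λ s → con two :* ((con ½ :* s) :* con 1ℚ :* con 1ℚ) := con two :* (con ½ :* s)) refl S)

  -- ψ i is numer i / (1 + y), which is a polynomial: see numerₕ≈S*ψ.
  ψ : ℕ → P2
  ψ zero          = X
  ψ (suc zero)    = X
  ψ (suc (suc i)) = (S ⊗ ψ (suc i)) ⊖ (Z ⊗ ψ i)

  numerₕ≈S*ψ : ∀ i → numerₕ i ≈ S * ψ i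
  numerₕ≈S*ψ zero          = numerₕ-0
  numerₕ≈S*ψ (suc zero)    = numerₕ-1
  numerₕ≈S*ψ (suc (suc i)) = begin
    numerₕ (suc (suc i))                 ≈⟨ numerₕ-rec i ⟩
    S * numerₕ (suc i) - Z * numerₕ i    ≈⟨ +-cong (*-congˡ {S} (numerₕ≈S*ψ (suc i))) (-‿cong (*-congˡ {Z} (numerₕ≈S*ψ i))) ⟩
    S * (S * ψ (suc i)) - Z * (S * ψ i)  ≈⟨ solve 4 (λ s z a b → s :* (s :* a) :- z :* (s :* b) := s :* (s :* a :- z :* b))
                                                  refl S Z (ψ (suc i)) (ψ i) ⟩
    S * ψ (suc (suc i))                  ∎

  numer≡ψ+shiftψ : ∀ i m l → numer i m l ≡ ψ i m l ℚ.+ shift (ψ i m) l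
  numer≡ψ+shiftψ i m l =
    P.trans (numer≈numerₕ i m l) (P.trans (numerₕ≈S*ψ i m l)
      (P.trans (S*≈+Y* m l) (P.cong (ψ i m l ℚ.+_) (P.trans (Y⊗≋shiftY (ψ i) m l) (shiftY≡shift l)))))
    where
    S*≈+Y* : S * ψ i ≈ ψ i + Y * ψ i
    S*≈+Y* = solve 2 (λ y f → (con 1ℚ :+ y) :* f := f :+ y :* f) refl Y (ψ i)
    shiftY≡shift : ∀ l → shiftY (ψ i) m l ≡ shift (ψ i m) l
    shiftY≡shift zero    = P.refl
    shiftY≡shift (suc l) = P.refl

  open ℚ-Solver renaming (solve to solveℚ; _:=_ to _:=ℚ_; _:+_ to _:+ℚ_; _:*_ to _:*ℚ_; con to conℚ; :-_ to :-ℚ_)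

  -- Multiplying by Σ_r (-y)^r undoes multiplication by 1 + y.
  Σ-sign-inverts-1+y : ∀ (g : ℕ → ℚ) j → Σ< (suc j) (λ l → sign (j ∸ l) ℚ.* (g l ℚ.+ shift g l)) ≡ g j
  Σ-sign-inverts-1+y g zero =
    solveℚ 1 (λ a → conℚ 0ℚ :+ℚ conℚ 1ℚ :*ℚ (a :+ℚ conℚ 0ℚ) :=ℚ a) P.refl (g 0)
  Σ-sign-inverts-1+y g (suc j) =
    P.trans (P.cong₂ ℚ._+_ lower top)
            (solveℚ 2 (λ a b → :-ℚ a :+ℚ conℚ 1ℚ :*ℚ (b :+ℚ a) :=ℚ b) P.refl (g j) (g (suc j)))
    where
    h : ℕ → ℚ
    h l = g l ℚ.+ shift g l
    lower : Σ< (suc j) (λ l → sign (suc j ∸ l) ℚ.* h l) ≡ ℚ.- g j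
    lower = P.trans (Σ<-cong< (suc j) (λ l l≤j → P.trans (P.cong (λ k → sign k ℚ.* h l) (ℕP.+-∸-assoc 1 (ℕP.≤-pred l≤j)))
                                                          (P.sym (ℚP.neg-distribˡ-* (sign (j ∸ l)) (h l)))))
                    (P.trans (P.sym (-‿Σ< (suc j) (λ l → sign (j ∸ l) ℚ.* h l))) (P.cong ℚ.-_ (Σ-sign-inverts-1+y g j)))
    top : sign (suc j ∸ suc j) ℚ.* h (suc j) ≡ 1ℚ ℚ.* (g (suc j) ℚ.+ g j)
    top = P.cong (λ k → sign k ℚ.* h (suc j)) (ℕP.n∸n≡0 j)

  coefA≡ψ : ∀ i j m → coefA i j m ≡ ψ i m j
  coefA≡ψ i j m = P.trans (Σ<-cong (suc j) (λ l → P.cong (sign (j ∸ l) ℚ.*_) (numer≡ψ+shiftψ i m l)))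
                          (Σ-sign-inverts-1+y (ψ i m) j)


module PsiIdentity where

  open import Defs
  open Bivariate
  open Psi using (ψ)
  open import Data.Nat as ℕ using (ℕ; zero; suc; _∸_; _<_)
  import Data.Nat.Properties as ℕP
  open import Data.Rational using (1ℚ)
  open import Data.Product using (_×_; _,_; proj₁)
  open import Algebra.Bundles using (CommutativeRing)
  import Relation.Binary.PropositionalEquality as P

  open CommutativeRing P2-ring
  open import Relation.Binary.Reasoning.Setoid setoid
  open P2-Solver using (solve; _:=_; _:+_; _:*_; _:-_; con)
  open ΣP2 using (Σ; Σ-cong<; Σ-+; *-distribˡ-Σ)

  D-term : ℕ → ℕ → P2
  D-term a a′ = ψ a′ - pow Y (a ∸ suc a′) * ψ a′

  D C : ℕ → P2
  D a = Σ a (D-term a)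
  C a = Σ a ψ

  D-suc : ∀ a → D (suc a) ≈ Y * D a + (1# - Y) * C a
  D-suc a = begin
    Σ a (D-term (suc a)) + D-term (suc a) a                   ≈⟨ +-cong (Σ-cong< a D-term-suc) D-term-diagonal ⟩
    Σ a (λ a′ → (1# - Y) * ψ a′ + Y * D-term a a′) + 0#      ≈⟨ +-identityʳ _ ⟩
    Σ a (λ a′ → (1# - Y) * ψ a′ + Y * D-term a a′)           ≈⟨ Σ-+ a _ _ ⟩
    Σ a (λ a′ → (1# - Y) * ψ a′) + Σ a (λ a′ → Y * D-term a a′)
      ≈⟨ +-cong (sym (*-distribˡ-Σ a (1# - Y) ψ)) (sym (*-distribˡ-Σ a Y (D-term a))) ⟩
    (1# - Y) * C a + Y * D a                                   ≈⟨ +-comm ((1# - Y) * C a) (Y * D a) ⟩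
    Y * D a + (1# - Y) * C a                                   ∎
    where
    D-term-suc : ∀ a′ → a′ < a → D-term (suc a) a′ ≈ (1# - Y) * ψ a′ + Y * D-term a a′
    D-term-suc a′ a′<a = begin
      ψ a′ - pow Y (suc a ∸ suc a′) * ψ a′   ≈⟨ reflexive (P.cong (λ k → ψ a′ - pow Y k * ψ a′) (ℕP.+-∸-assoc 1 a′<a)) ⟩
      ψ a′ - (Y * pow Y (a ∸ suc a′)) * ψ a′ ≈⟨ solve 3 (λ f y p → f :- (y :* p) :* f := (con 1ℚ :- y) :* f :+ y :* (f :- p :* f))
                                                      refl (ψ a′) Y (pow Y (a ∸ suc a′)) ⟩
      (1# - Y) * ψ a′ + Y * D-term a a′      ∎
    D-term-diagonal : D-term (suc a) a ≈ 0#
    D-term-diagonal = begin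
      ψ a - pow Y (a ∸ a) * ψ a ≈⟨ reflexive (P.cong (λ k → ψ a - pow Y k * ψ a) (ℕP.n∸n≡0 a)) ⟩
      ψ a - 1# * ψ a            ≈⟨ solve 1 (λ f → f :- con 1ℚ :* f := con 1ℚ :- con 1ℚ) refl (ψ a) ⟩
      1# - 1#                   ≈⟨ -‿inverseʳ 1# ⟩
      0#                        ∎

  private
    move-right : ∀ {p q r} → p + q ≈ r → p ≈ r - q
    move-right {p} {q} {r} p+q≈r = trans (solve 2 (λ p q → p := (p :+ q) :- q) refl p q) (+-congʳ p+q≈r)

  ψ+x²D≈x-pair : ∀ a → (ψ a + (X * X) * D a ≈ X) × (ψ (suc a) + (X * X) * D (suc a) ≈ X)
  ψ+x²D≈x-pair zero = base₀ , base₁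
    where
    base₀ : X + (X * X) * 0# ≈ X
    base₀ = trans (+-congˡ {X} (zeroʳ (X * X))) (+-identityʳ X)
    base₁ : X + (X * X) * (0# + (X - 1# * X)) ≈ X
    base₁ = begin
      X + (X * X) * (0# + (X - 1# * X)) ≈⟨ +-congˡ {X} (*-congˡ {X * X} (+-identityˡ (X - 1# * X))) ⟩
      X + (X * X) * (X - 1# * X)        ≈⟨ solve 1 (λ x → x :+ (x :* x) :* (x :- con 1ℚ :* x) := x) refl X ⟩
      X                                 ∎
  ψ+x²D≈x-pair (suc a) with ψ+x²D≈x-pair a
  ... | h₀ , h₁ = h₁ , h₂
    where
    d₀ = D a
    d₁ = D (suc a)
    c₀ = C a
    ψ₀ = move-right {ψ a} h₀
    h₂ : (S * ψ (suc a) - Z * ψ a) + (X * X) * D (suc (suc a)) ≈ X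
    h₂ = begin
      (S * ψ (suc a) - Z * ψ a) + (X * X) * D (suc (suc a))
        ≈⟨ +-cong (+-cong (*-congˡ {S} (move-right {ψ (suc a)} h₁)) (-‿cong (*-congˡ {Z} ψ₀)))
                  (*-congˡ {X * X} (D-suc (suc a))) ⟩
      (S * (X - (X * X) * d₁) - Z * (X - (X * X) * d₀)) + (X * X) * (Y * d₁ + (1# - Y) * (c₀ + ψ a))
        ≈⟨ +-congˡ {S * (X - (X * X) * d₁) - Z * (X - (X * X) * d₀)} (*-congˡ {X * X} (+-congˡ {Y * d₁} (*-congˡ {1# - Y} (+-congˡ {c₀} ψ₀)))) ⟩
      (S * (X - (X * X) * d₁) - Z * (X - (X * X) * d₀)) + (X * X) * (Y * d₁ + (1# - Y) * (c₀ + (X - (X * X) * d₀)))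
        ≈⟨ solve 5 (λ x y d₀ d₁ c₀ →
             ((con 1ℚ :+ y) :* (x :- (x :* x) :* d₁) :- ((x :* x) :* (con 1ℚ :- y) :+ y) :* (x :- (x :* x) :* d₀))
               :+ (x :* x) :* (y :* d₁ :+ (con 1ℚ :- y) :* (c₀ :+ (x :- (x :* x) :* d₀)))
             := x :+ (x :* x) :* ((y :* d₀ :+ (con 1ℚ :- y) :* c₀) :- d₁)) refl X Y d₀ d₁ c₀ ⟩
      X + (X * X) * ((Y * d₀ + (1# - Y) * c₀) - d₁) ≈⟨ +-congˡ {X} (*-congˡ {X * X} (+-congʳ { - d₁} (sym (D-suc a)))) ⟩
      X + (X * X) * (d₁ - d₁)                      ≈⟨ solve 2 (λ x d → x :+ (x :* x) :* (d :- d) := x) refl X d₁ ⟩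
      X                                            ∎

  ψ≈x-x²D : ∀ a → ψ a ≈ X - X * (X * D a)
  ψ≈x-x²D a = trans (move-right {ψ a} (proj₁ (ψ+x²D≈x-pair a))) (+-congˡ {X} (-‿cong (*-assoc X X (D a))))


module PsiDegree where

  open import Defs
  open Bivariate
  open Psi using (ψ)
  open import Data.Nat as ℕ using (ℕ; zero; suc; _≤_; _<_; z≤n; s≤s)
  import Data.Nat.Properties as ℕP
  open import Data.Rational using (0ℚ; 1ℚ; _+_; -_)
  import Data.Rational.Properties as ℚP
  open import Algebra.Bundles using (CommutativeRing)
  open import Relation.Binary.PropositionalEquality using (_≡_; refl; cong₂; trans)

  private
    module R = CommutativeRing P2-ring

  DegreeY≤ : P2 → ℕ → Set
  DegreeY≤ f d = ∀ m j → d < j → f m j ≡ 0ℚ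

  DegreeY-resp : ∀ {f g d} → f ≋ g → DegreeY≤ g d → DegreeY≤ f d
  DegreeY-resp f≋g g≤d m j d<j = trans (f≋g m j) (g≤d m j d<j)

  DegreeY-weaken : ∀ {f d d′} → DegreeY≤ f d → d ≤ d′ → DegreeY≤ f d′
  DegreeY-weaken f≤d d≤d′ m j d′<j = f≤d m j (ℕP.≤-<-trans d≤d′ d′<j)

  DegreeY-⊕ : ∀ {f g d} → DegreeY≤ f d → DegreeY≤ g d → DegreeY≤ (f ⊕ g) d
  DegreeY-⊕ f≤d g≤d m j d<j = trans (cong₂ _+_ (f≤d m j d<j) (g≤d m j d<j)) (ℚP.+-identityʳ 0ℚ)

  DegreeY-⊖ : ∀ {f g d} → DegreeY≤ f d → DegreeY≤ g d → DegreeY≤ (f ⊖ g) d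
  DegreeY-⊖ f≤d g≤d m j d<j = trans (cong₂ (λ x y → x + - y) (f≤d m j d<j) (g≤d m j d<j)) (ℚP.+-inverseʳ 0ℚ)

  DegreeY-shiftX : ∀ {f d} → DegreeY≤ f d → DegreeY≤ (shiftX f) d
  DegreeY-shiftX f≤d zero    j _   = refl
  DegreeY-shiftX f≤d (suc m) j d<j = f≤d m j d<j

  DegreeY-shiftY : ∀ {f d} → DegreeY≤ f d → DegreeY≤ (shiftY f) (suc d)
  DegreeY-shiftY f≤d m (suc j) (s≤s d<j) = f≤d m j d<j

  DegreeY-X : DegreeY≤ X 0
  DegreeY-X m (suc j) _ = ℚP.*-zeroʳ (δ 1 m)

  S⊗≋ : ∀ f → (S ⊗ f) ≋ (f ⊕ shiftY f)
  S⊗≋ f m j = trans (R.distribʳ f (cst 1ℚ) Y m j)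
                    (cong₂ _+_ (trans (cst⊗≋scale 1ℚ f m j) (ℚP.*-identityˡ (f m j))) (Y⊗≋shiftY f m j))

  Z⊗≋ : ∀ f → (Z ⊗ f) ≋ ((shiftX (shiftX f) ⊖ shiftX (shiftX (shiftY f))) ⊕ shiftY f)
  Z⊗≋ f m j = trans (expand m j) (cong₂ _+_ (cong₂ (λ x y → x + - y) (X²⊗≋ f m j)
                                                    (trans (X²⊗≋ (Y ⊗ f) m j) (shiftX²-cong (Y⊗≋shiftY f) m j)))
                                            (Y⊗≋shiftY f m j))
    where
    open P2-Solver using (solve; _:=_; _:+_; _:-_; _:*_; con)
    expand : (Z ⊗ f) ≋ (((X ⊗ (X ⊗ f)) ⊖ (X ⊗ (X ⊗ (Y ⊗ f)))) ⊕ (Y ⊗ f))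
    expand = solve 3 (λ x y f → ((x :* x) :* (con 1ℚ :- y) :+ y) :* f := (x :* (x :* f) :- x :* (x :* (y :* f))) :+ y :* f)
                     R.refl X Y f
    X²⊗≋ : ∀ g → (X ⊗ (X ⊗ g)) ≋ shiftX (shiftX g)
    X²⊗≋ g zero    j = X⊗≋shiftX (X ⊗ g) zero j
    X²⊗≋ g (suc m) j = trans (X⊗≋shiftX (X ⊗ g) (suc m) j) (X⊗≋shiftX g m j)
    shiftX²-cong : ∀ {g h} → g ≋ h → shiftX (shiftX g) ≋ shiftX (shiftX h)
    shiftX²-cong g≋h zero          j = refl
    shiftX²-cong g≋h (suc zero)    j = refl
    shiftX²-cong g≋h (suc (suc m)) j = g≋h m j

  ψ-degreeY-step : ∀ a → DegreeY≤ (ψ (suc a)) (suc a) → DegreeY≤ (ψ a) a → DegreeY≤ (ψ (suc (suc a))) (suc (suc a))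
  ψ-degreeY-step a ψ₁ ψ₀≤a = DegreeY-⊖ S-part Z-part
    where
    ψ₀ : DegreeY≤ (ψ a) (suc a)
    ψ₀ = DegreeY-weaken ψ₀≤a (ℕP.n≤1+n a)
    S-part : DegreeY≤ (S ⊗ ψ (suc a)) (suc (suc a))
    S-part = DegreeY-resp (S⊗≋ (ψ (suc a))) (DegreeY-⊕ (DegreeY-weaken ψ₁ (ℕP.n≤1+n (suc a))) (DegreeY-shiftY ψ₁))
    Z-part : DegreeY≤ (Z ⊗ ψ a) (suc (suc a))
    Z-part = DegreeY-resp (Z⊗≋ (ψ a))
      (DegreeY-⊕ (DegreeY-⊖ (DegreeY-shiftX (DegreeY-shiftX (DegreeY-weaken ψ₀ (ℕP.n≤1+n (suc a)))))
                            (DegreeY-shiftX (DegreeY-shiftX (DegreeY-shiftY ψ₀))))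
                 (DegreeY-shiftY ψ₀))

  ψ-degreeY : ∀ a → DegreeY≤ (ψ a) a
  ψ-degreeY zero          = DegreeY-X
  ψ-degreeY (suc zero)    = DegreeY-weaken DegreeY-X z≤n
  ψ-degreeY (suc (suc a)) = ψ-degreeY-step a (ψ-degreeY (suc a)) (ψ-degreeY a)


-- pair F k N = [x^N] Σ_{j<k} ([y^j] F) · W_{k-j}(x), where W_k′(x) = Σ_n W n k′ xⁿ.
module Pairing (W : ℕ → ℕ → ℚ) where

  open import Defs
  open Bivariate
  open RationalSum
  open import Data.Nat as ℕ using (ℕ; zero; suc; _∸_; _≤_; s≤s)
  open import Data.Rational as ℚ using (ℚ; 0ℚ; 1ℚ; _+_; _*_; -_)
  import Data.Rational.Properties as ℚP
  open import Algebra.Bundles using (CommutativeRing)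
  open import Relation.Binary.PropositionalEquality using (_≡_; cong; cong₂; sym; trans; module ≡-Reasoning)
  open ≡-Reasoning

  pair : P2 → ℕ → ℕ → ℚ
  pair F k N = Σ< k (λ j → Σ< (suc N) (λ m → F m j * W (N ∸ m) (k ∸ j)))

  pair-cong : ∀ {F G} → F ≋ G → ∀ k N → pair F k N ≡ pair G k N
  pair-cong F≋G k N = Σ<-cong k (λ j → Σ<-cong (suc N) (λ m → cong (_* W (N ∸ m) (k ∸ j)) (F≋G m j)))

  pair-⊕ : ∀ F G k N → pair (F ⊕ G) k N ≡ pair F k N + pair G k N
  pair-⊕ F G k N = trans (Σ<-cong k (λ j → trans (Σ<-cong (suc N) (λ m → ℚP.*-distribʳ-+ _ (F m j) (G m j)))
                                                 (Σ<-+ (suc N) _ _)))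
                         (Σ<-+ k _ _)

  pair-neg : ∀ F k N → pair (λ m j → - F m j) k N ≡ - pair F k N
  pair-neg F k N = trans (Σ<-cong k (λ j → trans (Σ<-cong (suc N) (λ m → sym (ℚP.neg-distribˡ-* (F m j) _)))
                                                (sym (-‿Σ< (suc N) _))))
                       (sym (-‿Σ< k _))

  pair-sub : ∀ F G k N → pair (λ m j → F m j ℚ.- G m j) k N ≡ pair F k N ℚ.- pair G k N
  pair-sub F G k N = trans (pair-⊕ F (λ m j → - G m j) k N) (cong (pair F k N +_) (pair-neg G k N))

  pair-Σ : ∀ n Fs k N → pair (ΣP2.Σ n Fs) k N ≡ Σ< n (λ i → pair (Fs i) k N)
  pair-Σ zero    Fs k N = Σ<-zero k (λ j _ → Σ<-zero (suc N) (λ m _ → ℚP.*-zeroˡ (W (N ∸ m) (k ∸ j))))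
  pair-Σ (suc n) Fs k N = trans (pair-⊕ (ΣP2.Σ n Fs) (Fs n) k N) (cong (_+ pair (Fs n) k N) (pair-Σ n Fs k N))

  pair-1 : ∀ k N → pair (cst 1ℚ) (suc k) N ≡ W N (suc k)
  pair-1 k N = begin
    Σ< (suc k) (λ j → Σ< (suc N) (λ m → cst 1ℚ m j * W (N ∸ m) (suc k ∸ j)))      ≡⟨ Σ<-head k _ ⟩
    Σ< (suc N) (λ m → cst 1ℚ m 0 * W (N ∸ m) (suc k))
      + Σ< k (λ j → Σ< (suc N) (λ m → cst 1ℚ m (suc j) * W (N ∸ m) (k ∸ j)))
      ≡⟨ cong₂ _+_ (trans (Σ<-cong (suc N) (λ m → cong (_* W (N ∸ m) (suc k))
                                                      (trans (ℚP.*-identityʳ (1ℚ * δ 0 m)) (ℚP.*-identityˡ (δ 0 m)))))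
                          (Σ<-δ₀ N (λ m → W (N ∸ m) (suc k))))
                   (Σ<-zero k (λ j _ → Σ<-zero (suc N) (λ m _ →
                      trans (cong (_* W (N ∸ m) (k ∸ j)) (ℚP.*-zeroʳ (1ℚ * δ 0 m))) (ℚP.*-zeroˡ (W (N ∸ m) (k ∸ j)))))) ⟩
    W N (suc k) + 0ℚ                                                              ≡⟨ ℚP.+-identityʳ _ ⟩
    W N (suc k)                                                                   ∎

  pair-X⊗-zero : ∀ G k → pair (X ⊗ G) k 0 ≡ 0ℚ
  pair-X⊗-zero G k = Σ<-zero k (λ j _ →
    trans (ℚP.+-identityˡ _) (trans (cong (_* W 0 (k ∸ j)) (X⊗≋shiftX G 0 j)) (ℚP.*-zeroˡ (W 0 (k ∸ j)))))

  pair-X⊗-suc : ∀ G k N → pair (X ⊗ G) k (suc N) ≡ pair G k N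
  pair-X⊗-suc G k N = Σ<-cong k (λ j → begin
    Σ< (suc (suc N)) (λ m → (X ⊗ G) m j * W (suc N ∸ m) (k ∸ j))
      ≡⟨ Σ<-cong (suc (suc N)) (λ m → cong (_* W (suc N ∸ m) (k ∸ j)) (X⊗≋shiftX G m j)) ⟩
    Σ< (suc (suc N)) (λ m → shiftX G m j * W (suc N ∸ m) (k ∸ j))
      ≡⟨ Σ<-head (suc N) _ ⟩
    0ℚ * W (suc N) (k ∸ j) + Σ< (suc N) (λ m → G m j * W (N ∸ m) (k ∸ j))
      ≡⟨ cong (_+ Σ< (suc N) (λ m → G m j * W (N ∸ m) (k ∸ j))) (ℚP.*-zeroˡ (W (suc N) (k ∸ j))) ⟩
    0ℚ + Σ< (suc N) (λ m → G m j * W (N ∸ m) (k ∸ j))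
      ≡⟨ ℚP.+-identityˡ _ ⟩
    Σ< (suc N) (λ m → G m j * W (N ∸ m) (k ∸ j)) ∎)

  pair-Y⊗ : ∀ H k N → pair (Y ⊗ H) (suc k) N ≡ pair H k N
  pair-Y⊗ H k N = begin
    pair (Y ⊗ H) (suc k) N ≡⟨ Σ<-head k _ ⟩
    Σ< (suc N) (λ m → (Y ⊗ H) m 0 * W (N ∸ m) (suc k))
      + Σ< k (λ j → Σ< (suc N) (λ m → (Y ⊗ H) m (suc j) * W (N ∸ m) (k ∸ j)))
      ≡⟨ cong₂ _+_ (Σ<-zero (suc N) (λ m _ → trans (cong (_* W (N ∸ m) (suc k)) (Y⊗≋shiftY H m 0)) (ℚP.*-zeroˡ (W (N ∸ m) (suc k)))))
                   (pair-cong (λ m j → Y⊗≋shiftY H m (suc j)) k N) ⟩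
    0ℚ + pair H k N        ≡⟨ ℚP.+-identityˡ _ ⟩
    pair H k N             ∎

  pair-pow-Y⊗ : ∀ d G k N → d ≤ k → pair (pow Y d ⊗ G) k N ≡ pair G (k ∸ d) N
  pair-pow-Y⊗ zero    G k       N _ = pair-cong (λ m j → trans (cst⊗≋scale 1ℚ G m j) (ℚP.*-identityˡ (G m j))) k N
  pair-pow-Y⊗ (suc d) G (suc k) N (s≤s d≤k) =
    trans (pair-cong (CommutativeRing.*-assoc P2-ring Y (pow Y d) G) (suc k) N)
          (trans (pair-Y⊗ (pow Y d ⊗ G) k N) (pair-pow-Y⊗ d G k N d≤k))


module Counting where

  open import Data.Nat as ℕ using (ℕ; zero; suc; _+_; _∸_; _≤_; _<_; s≤s; _≟_; _<?_; _≤?_)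
  import Data.Nat.Properties as ℕP
  open import Data.Bool using (Bool; true; false; not; _∧_; _∨_; if_then_else_)
  open import Data.Bool.Properties using (∧-zeroʳ)
  open import Data.List using (List; []; _∷_; map)
  open import Relation.Nullary using (yes; no; does; contradiction)
  open import Relation.Nullary.Decidable using (dec-true; dec-false)
  open import Relation.Binary.Definitions using (tri<; tri≈; tri>)
  open import Relation.Binary.PropositionalEquality as P using (_≡_; _≢_; refl; cong; cong₂; trans; sym)
  open P.≡-Reasoning

  module Σℕ = FiniteSum ℕP.+-*-commutativeSemiring
  open Σℕ using (Σ; Σ-cong<; Σ-cong; Σ-zero; Σ-+; Σ-split; Σ-update)

  -- Words over [k] are lists of the letters 0, …, k - 1.
  count : ℕ → ℕ → (List ℕ → Bool) → ℕ
  count zero    k P = if P [] then 1 else 0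
  count (suc n) k P = Σ k (λ c → count n k (λ l → P (c ∷ l)))

  count-cong : ∀ n k {P Q} → (∀ l → P l ≡ Q l) → count n k P ≡ count n k Q
  count-cong zero    k P≡Q = cong (λ b → if b then 1 else 0) (P≡Q [])
  count-cong (suc n) k P≡Q = Σ-cong k (λ c → count-cong n k (λ l → P≡Q (c ∷ l)))

  count-none : ∀ n k {P} → (∀ l → P l ≡ false) → count n k P ≡ 0
  count-none zero    k P≡false = cong (λ b → if b then 1 else 0) (P≡false [])
  count-none (suc n) k P≡false = Σ-zero k (λ c _ → count-none n k (λ l → P≡false (c ∷ l)))

  between : ℕ → ℕ → ℕ → Bool
  between s e d = does (s <? d) ∧ does (d <? e)

  anyBetween : ℕ → ℕ → List ℕ → Bool
  anyBetween s e []      = false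
  anyBetween s e (d ∷ r) = between s e d ∨ anyBetween s e r

  -- An occurrence of 113-2 at the head of a b c r means a = b and a letter of r strictly between a and c.
  has1132 : List ℕ → Bool
  has1132 (a ∷ b ∷ c ∷ r) = (does (a ≟ b) ∧ anyBetween a c r) ∨ has1132 (b ∷ c ∷ r)
  has1132 _               = false

  has1132-cons-≢ : ∀ {s d} → s ≢ d → ∀ l → has1132 (s ∷ d ∷ l) ≡ has1132 (d ∷ l)
  has1132-cons-≢ s≢d []      = refl
  has1132-cons-≢ {s} {d} s≢d (e ∷ r) = cong (λ b → (b ∧ anyBetween s e r) ∨ has1132 (d ∷ e ∷ r)) (dec-false (s ≟ d) s≢d)

  has1132-cons-≡ : ∀ s e r → has1132 (s ∷ s ∷ e ∷ r) ≡ anyBetween s e r ∨ has1132 (s ∷ e ∷ r)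
  has1132-cons-≡ s e r = cong (λ b → (b ∧ anyBetween s e r) ∨ has1132 (s ∷ e ∷ r)) (dec-true (s ≟ s) refl)

  between-empty : ∀ {s e} → e ≤ s → ∀ d → between s e d ≡ false
  between-empty {s} {e} e≤s d with s <? d
  ... | yes s<d = trans (cong (does (s <? d) ∧_) (dec-false (d <? e) (λ d<e → ℕP.<-asym s<d (ℕP.<-≤-trans d<e e≤s))))
                        (∧-zeroʳ (does (s <? d)))
  ... | no  s≮d = cong (_∧ does (d <? e)) (dec-false (s <? d) s≮d)

  anyBetween-empty : ∀ {s e} → e ≤ s → ∀ r → anyBetween s e r ≡ false
  anyBetween-empty e≤s []      = refl
  anyBetween-empty e≤s (d ∷ r) = cong₂ _∨_ (between-empty e≤s d) (anyBetween-empty e≤s r)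

  avoiding : ℕ → ℕ → ℕ
  avoiding n k = count n k (λ l → not (has1132 l))

  avoidingFrom : ℕ → ℕ → ℕ → ℕ
  avoidingFrom s k n = count n k (λ l → not (has1132 (s ∷ l)))

  module Monotone (f : ℕ → ℕ) (f-mono : ∀ {x y} → x < y → f x < f y) where

    <?-map : ∀ x y → does (f x <? f y) ≡ does (x <? y)
    <?-map x y with ℕP.<-cmp x y
    ... | tri< x<y _ _ = trans (dec-true (f x <? f y) (f-mono x<y)) (sym (dec-true (x <? y) x<y))
    ... | tri≈ _ refl _ = trans (dec-false (f x <? f x) (ℕP.<-irrefl refl)) (sym (dec-false (x <? x) (ℕP.<-irrefl refl)))
    ... | tri> _ _ y<x = trans (dec-false (f x <? f y) (ℕP.<-asym (f-mono y<x))) (sym (dec-false (x <? y) (ℕP.<-asym y<x)))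

    ≟-map : ∀ x y → does (f x ≟ f y) ≡ does (x ≟ y)
    ≟-map x y with ℕP.<-cmp x y
    ... | tri< x<y _ _ = trans (dec-false (f x ≟ f y) (ℕP.<⇒≢ (f-mono x<y))) (sym (dec-false (x ≟ y) (ℕP.<⇒≢ x<y)))
    ... | tri≈ _ refl _ = trans (dec-true (f x ≟ f x) refl) (sym (dec-true (x ≟ x) refl))
    ... | tri> _ _ y<x = trans (dec-false (f x ≟ f y) (ℕP.>⇒≢ (f-mono y<x))) (sym (dec-false (x ≟ y) (ℕP.>⇒≢ y<x)))

    anyBetween-map : ∀ a c r → anyBetween (f a) (f c) (map f r) ≡ anyBetween a c r
    anyBetween-map a c []      = refl
    anyBetween-map a c (d ∷ r) = cong₂ _∨_ (cong₂ _∧_ (<?-map a d) (<?-map d c)) (anyBetween-map a c r)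

    has1132-map : ∀ l → has1132 (map f l) ≡ has1132 l
    has1132-map []              = refl
    has1132-map (a ∷ [])        = refl
    has1132-map (a ∷ b ∷ [])    = refl
    has1132-map (a ∷ b ∷ c ∷ r) = cong₂ _∨_ (cong₂ _∧_ (≟-map a b) (anyBetween-map a c r)) (has1132-map (b ∷ c ∷ r))

  -- Embeds [s + 1 + m] into [s + 1 + g + m], leaving out the g letters after s.
  skip : ℕ → ℕ → ℕ → ℕ
  skip s g x = if does (x ≤? s) then x else x + g

  skip-low : ∀ s g {x} → x ≤ s → skip s g x ≡ x
  skip-low s g {x} x≤s = cong (λ b → if b then x else x + g) (dec-true (x ≤? s) x≤s)

  skip-high : ∀ s g {x} → s < x → skip s g x ≡ x + g
  skip-high s g {x} s<x = cong (λ b → if b then x else x + g) (dec-false (x ≤? s) (ℕP.<⇒≱ s<x))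

  skip-mono : ∀ s g {x y} → x < y → skip s g x < skip s g y
  skip-mono s g {x} {y} x<y with x ≤? s | y ≤? s
  ... | yes x≤s | yes y≤s rewrite skip-low s g x≤s | skip-low s g y≤s = x<y
  ... | yes x≤s | no  y≰s rewrite skip-low s g x≤s | skip-high s g (ℕP.≰⇒> y≰s) = ℕP.<-≤-trans x<y (ℕP.m≤m+n y g)
  ... | no  x≰s | yes y≤s = contradiction (ℕP.≤-trans (ℕP.<⇒≤ x<y) y≤s) x≰s
  ... | no  x≰s | no  y≰s rewrite skip-high s g (ℕP.≰⇒> x≰s) | skip-high s g (ℕP.≰⇒> y≰s) = ℕP.+-monoˡ-< g x<y

  module _ {s e : ℕ} (s<e : s < e) where

    private
      g = e ∸ suc s
      1+s+g≡e : suc s + g ≡ e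
      1+s+g≡e = ℕP.m+[n∸m]≡n s<e

    skip-above : ∀ i → skip s g (suc s + i) ≡ e + i
    skip-above i = begin
      skip s g (suc s + i) ≡⟨ skip-high s g (s≤s (ℕP.m≤m+n s i)) ⟩
      suc s + i + g        ≡⟨ ℕP.+-assoc (suc s) i g ⟩
      suc s + (i + g)      ≡⟨ cong (suc s +_) (ℕP.+-comm i g) ⟩
      suc s + (g + i)      ≡⟨ sym (ℕP.+-assoc (suc s) g i) ⟩
      suc s + g + i        ≡⟨ cong (_+ i) 1+s+g≡e ⟩
      e + i                ∎

    between-skip : ∀ c → between s e (skip s g c) ≡ false
    between-skip c with c ≤? s
    ... | yes c≤s rewrite skip-low s g c≤s = cong (_∧ does (c <? e)) (dec-false (s <? c) (ℕP.≤⇒≯ c≤s))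
    ... | no  c≰s rewrite skip-high s g (ℕP.≰⇒> c≰s) =
      trans (cong (does (s <? c + g) ∧_) (dec-false (c + g <? e) (ℕP.≤⇒≯ e≤c+g))) (∧-zeroʳ _)
      where
      e≤c+g : e ≤ c + g
      e≤c+g = ℕP.≤-trans (ℕP.≤-reflexive (sym 1+s+g≡e)) (ℕP.+-monoˡ-≤ g (ℕP.≰⇒> c≰s))

    Σ-skip : ∀ {k} → e ≤ k → (f : ℕ → ℕ) → (∀ c → s < c → c < e → f c ≡ 0) →
             Σ k f ≡ Σ (suc s + (k ∸ e)) (λ c → f (skip s g c))
    Σ-skip {k} e≤k f f-between = begin
      Σ k f                                                                ≡⟨ cong (λ m → Σ m f) (sym k≡) ⟩
      Σ (suc s + g + (k ∸ e)) f                                            ≡⟨ Σ-split (suc s + g) (k ∸ e) f ⟩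
      Σ (suc s + g) f + Σ (k ∸ e) (λ i → f (suc s + g + i))                ≡⟨ cong (_+ Σ (k ∸ e) (λ i → f (suc s + g + i))) (Σ-split (suc s) g f) ⟩
      (Σ (suc s) f + Σ g (λ i → f (suc s + i))) + Σ (k ∸ e) (λ i → f (suc s + g + i))
        ≡⟨ cong₂ _+_ (cong (Σ (suc s) f +_) (Σ-zero g (λ i i<g → f-between (suc s + i) (s≤s (ℕP.m≤m+n s i)) (below i<g))))
                     (Σ-cong (k ∸ e) (λ i → cong (λ x → f (x + i)) 1+s+g≡e)) ⟩
      (Σ (suc s) f + 0) + Σ (k ∸ e) (λ i → f (e + i))                     ≡⟨ cong (_+ Σ (k ∸ e) (λ i → f (e + i))) (ℕP.+-identityʳ (Σ (suc s) f)) ⟩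
      Σ (suc s) f + Σ (k ∸ e) (λ i → f (e + i))
        ≡⟨ sym (cong₂ _+_ (Σ-cong< (suc s) (λ c c≤s → cong f (skip-low s g (ℕP.≤-pred c≤s))))
                          (Σ-cong (k ∸ e) (λ i → cong f (skip-above i)))) ⟩
      Σ (suc s) (λ c → f (skip s g c)) + Σ (k ∸ e) (λ i → f (skip s g (suc s + i)))
        ≡⟨ sym (Σ-split (suc s) (k ∸ e) (λ c → f (skip s g c))) ⟩
      Σ (suc s + (k ∸ e)) (λ c → f (skip s g c))                          ∎
      where
      k≡ : suc s + g + (k ∸ e) ≡ k
      k≡ = trans (cong (_+ (k ∸ e)) 1+s+g≡e) (ℕP.m+[n∸m]≡n e≤k)
      below : ∀ {i} → i < g → suc s + i < e
      below i<g = ℕP.<-≤-trans (ℕP.+-monoʳ-< (suc s) i<g) (ℕP.≤-reflexive 1+s+g≡e)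

    count-avoidBetween : ∀ n {k} (P : List ℕ → Bool) → e ≤ k →
      count n k (λ r → not (anyBetween s e r) ∧ P r) ≡ count n (suc s + (k ∸ e)) (λ r → P (map (skip s g) r))
    count-avoidBetween zero    P e≤k = refl
    count-avoidBetween (suc n) {k} P e≤k = begin
      Σ k f                                                         ≡⟨ Σ-skip e≤k f f-between ⟩
      Σ (suc s + (k ∸ e)) (λ c → f (skip s g c))                   ≡⟨ Σ-cong (suc s + (k ∸ e)) relabel ⟩
      Σ (suc s + (k ∸ e)) (λ c → count n (suc s + (k ∸ e)) (λ r → P (skip s g c ∷ map (skip s g) r))) ∎
      where
      f : ℕ → ℕ
      f c = count n k (λ l → not (between s e c ∨ anyBetween s e l) ∧ P (c ∷ l))
      f-between : ∀ c → s < c → c < e → f c ≡ 0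
      f-between c s<c c<e = count-none n k (λ l →
        cong (λ b → not (b ∨ anyBetween s e l) ∧ P (c ∷ l)) (cong₂ _∧_ (dec-true (s <? c) s<c) (dec-true (c <? e) c<e)))
      relabel : ∀ c → f (skip s g c) ≡ count n (suc s + (k ∸ e)) (λ r → P (skip s g c ∷ map (skip s g) r))
      relabel c = trans (count-cong n k (λ l → cong (λ b → not (b ∨ anyBetween s e l) ∧ P (skip s g c ∷ l)) (between-skip c)))
                        (count-avoidBetween n (λ l → P (skip s g c ∷ l)) e≤k)

  private
    not-∨ : ∀ a b → not (a ∨ b) ≡ not a ∧ not b
    not-∨ true  b = refl
    not-∨ false b = refl

  -- s s e r avoids 113-2 iff s e r does and, when s < e, no letter of r lies in (s, e);
  -- removing those e - s - 1 letters and relabelling sends e to s + 1.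
  avoidingFrom-double : ∀ {s e} k n → s < e → e ≤ k →
    count n k (λ r → not (has1132 (s ∷ s ∷ e ∷ r))) ≡ avoidingFrom (suc s) (suc s + (k ∸ e)) n
  avoidingFrom-double {s} {e} k n s<e e≤k = begin
    count n k (λ r → not (has1132 (s ∷ s ∷ e ∷ r)))
      ≡⟨ count-cong n k (λ r → trans (cong not (trans (has1132-cons-≡ s e r) (cong (anyBetween s e r ∨_) (has1132-cons-≢ s≢e r))))
                                     (not-∨ (anyBetween s e r) (has1132 (e ∷ r)))) ⟩
    count n k (λ r → not (anyBetween s e r) ∧ not (has1132 (e ∷ r)))
      ≡⟨ count-avoidBetween s<e n (λ r → not (has1132 (e ∷ r))) e≤k ⟩
    count n (suc s + (k ∸ e)) (λ r → not (has1132 (e ∷ map (skip s g) r)))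
      ≡⟨ count-cong n _ (λ r → cong not (trans (cong (λ x → has1132 (x ∷ map (skip s g) r)) (sym skip-1+s))
                                               (has1132-map (suc s ∷ r)))) ⟩
    avoidingFrom (suc s) (suc s + (k ∸ e)) n ∎
    where
    g = e ∸ suc s
    s≢e : s ≢ e
    s≢e = ℕP.<⇒≢ s<e
    skip-1+s : skip s g (suc s) ≡ e
    skip-1+s = trans (skip-high s g (ℕP.n<1+n s)) (ℕP.m+[n∸m]≡n s<e)
    open Monotone (skip s g) (skip-mono s g)

  avoidingFrom-suc-suc : ∀ s k n → s < k →
    avoidingFrom s k (suc (suc n)) + Σ k (λ e → if does (s <? e) then avoidingFrom e k n else 0)
      ≡ avoiding (suc (suc n)) k + Σ k (λ e → if does (s <? e) then avoidingFrom (suc s) (suc s + (k ∸ e)) n else 0)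
  avoidingFrom-suc-suc s k n s<k = Σ-update k s s<k off-diagonal diagonal
    where
    sameFirst = λ e → count n k (λ r → not (has1132 (s ∷ s ∷ e ∷ r)))
    larger    = λ e → if does (s <? e) then avoidingFrom e k n else 0
    relabeled = λ e → if does (s <? e) then avoidingFrom (suc s) (suc s + (k ∸ e)) n else 0

    off-diagonal : ∀ d → d ≢ s → count (suc n) k (λ l → not (has1132 (s ∷ d ∷ l))) ≡ avoidingFrom d k (suc n)
    off-diagonal d d≢s = count-cong (suc n) k (λ l → cong not (has1132-cons-≢ (λ s≡d → d≢s (sym s≡d)) l))

    pointwise : ∀ e → e < k → sameFirst e + larger e ≡ count n k (λ r → not (has1132 (s ∷ e ∷ r))) + relabeled e
    pointwise e e<k with s <? e
    ... | no s≮e rewrite dec-false (s <? e) s≮e = cong (_+ 0) (count-cong n k (λ r → cong not (trans (has1132-cons-≡ s e r)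
                                  (cong (_∨ has1132 (s ∷ e ∷ r)) (anyBetween-empty (ℕP.≮⇒≥ s≮e) r)))))
    ... | yes s<e rewrite dec-true (s <? e) s<e = begin
      sameFirst e + avoidingFrom e k n                    ≡⟨ ℕP.+-comm (sameFirst e) _ ⟩
      avoidingFrom e k n + sameFirst e                    ≡⟨ cong₂ _+_ (count-cong n k (λ r → cong not (sym (has1132-cons-≢ (ℕP.<⇒≢ s<e) r))))
                                                                       (avoidingFrom-double k n s<e (ℕP.<⇒≤ e<k)) ⟩
      count n k (λ r → not (has1132 (s ∷ e ∷ r))) + avoidingFrom (suc s) (suc s + (k ∸ e)) n ∎

    diagonal : Σ k sameFirst + Σ k larger ≡ avoidingFrom s k (suc n) + Σ k relabeled
    diagonal = begin
      Σ k sameFirst + Σ k larger                 ≡⟨ sym (Σ-+ k sameFirst larger) ⟩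
      Σ k (λ e → sameFirst e + larger e)         ≡⟨ Σ-cong< k pointwise ⟩
      Σ k (λ e → count n k (λ r → not (has1132 (s ∷ e ∷ r))) + relabeled e) ≡⟨ Σ-+ k _ relabeled ⟩
      avoidingFrom s k (suc n) + Σ k relabeled   ∎


module Pattern where

  open import Defs
  open import Data.Nat as ℕ using (ℕ; suc; _<_; _<?_)
  import Data.Nat.Properties as ℕP
  open import Data.List using (List; []; _∷_; filter; length; deduplicate)
  import Data.List.Properties as LP
  open import Data.Product using (_×_; _,_; proj₁; proj₂)
  open import Function using (_∘_)
  open import Relation.Nullary using (¬_; yes; no; ¬?; contradiction)
  open import Relation.Binary.PropositionalEquality as P using (_≡_; _≢_; refl; cong; cong₂; sym; trans; subst)

  below : ℕ → List ℕ → List ℕ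
  below x = filter (_<? x)

  dedup : List ℕ → List ℕ
  dedup = deduplicate ℕP._≟_

  rank : List ℕ → ℕ → ℕ
  rank u x = suc (length (dedup (below x u)))

  below-∷-< : ∀ {x y} ys → y < x → below x (y ∷ ys) ≡ y ∷ below x ys
  below-∷-< {x} ys = LP.filter-accept (_<? x)

  below-∷-≮ : ∀ {x y} ys → ¬ y < x → below x (y ∷ ys) ≡ below x ys
  below-∷-≮ {x} ys = LP.filter-reject (_<? x)

  dedup-∷∷ : ∀ a → dedup (a ∷ a ∷ []) ≡ a ∷ []
  dedup-∷∷ a = cong (a ∷_) (LP.filter-reject (¬? ∘ ℕP._≟_ a) (λ a≢a → a≢a refl))

  dedup-∷-≢ : ∀ {a d} → a ≢ d → dedup (a ∷ a ∷ d ∷ []) ≡ a ∷ d ∷ []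
  dedup-∷-≢ {a} {d} a≢d = cong (a ∷_)
    (trans (LP.filter-reject ≢a? (λ a≢a → a≢a refl))
    (trans (cong (filter ≢a?) (LP.filter-accept ≢a? a≢d)) (LP.filter-accept ≢a? a≢d)))
    where ≢a? = ¬? ∘ ℕP._≟_ a

  orderIso-1132⇐ : ∀ a c d → a < d → d < c → OrderIso (a ∷ a ∷ c ∷ d ∷ []) pattern1132
  orderIso-1132⇐ a c d a<d d<c = cong₂ _∷_ rank-a (cong₂ _∷_ rank-a (cong₂ _∷_ rank-c (cong₂ _∷_ rank-d refl)))
    where
    u = a ∷ a ∷ c ∷ d ∷ []
    a<c = ℕP.<-trans a<d d<c
    rank-a : rank u a ≡ 1
    rank-a = cong (suc ∘ length ∘ dedup)
      (trans (below-∷-≮ {a} {a} (a ∷ c ∷ d ∷ []) (ℕP.<-irrefl refl)) (trans (below-∷-≮ {a} {a} (c ∷ d ∷ []) (ℕP.<-irrefl refl))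
        (trans (below-∷-≮ {a} {c} (d ∷ []) (ℕP.<-asym a<c)) (below-∷-≮ {a} {d} [] (ℕP.<-asym a<d)))))
    rank-c : rank u c ≡ 3
    rank-c = cong (suc ∘ length) (trans (cong dedup below-c) (dedup-∷-≢ (ℕP.<⇒≢ a<d)))
      where
      below-c : below c u ≡ a ∷ a ∷ d ∷ []
      below-c = trans (below-∷-< (a ∷ c ∷ d ∷ []) a<c) (cong (a ∷_) (trans (below-∷-< (c ∷ d ∷ []) a<c) (cong (a ∷_)
                  (trans (below-∷-≮ {c} {c} (d ∷ []) (ℕP.<-irrefl refl)) (below-∷-< [] d<c)))))
    rank-d : rank u d ≡ 2
    rank-d = cong (suc ∘ length) (trans (cong dedup below-d) (dedup-∷∷ a))
      where
      below-d : below d u ≡ a ∷ a ∷ []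
      below-d = trans (below-∷-< (a ∷ c ∷ d ∷ []) a<d) (cong (a ∷_) (trans (below-∷-< (c ∷ d ∷ []) a<d) (cong (a ∷_)
                  (trans (below-∷-≮ {d} {c} (d ∷ []) (ℕP.<-asym d<c)) (below-∷-≮ {d} {d} [] (ℕP.<-irrefl refl))))))

  dedup≡[]⇒≡[] : ∀ xs → length (dedup xs) ≡ 0 → xs ≡ []
  dedup≡[]⇒≡[] []      _ = refl
  dedup≡[]⇒≡[] (x ∷ xs) ()

  below-∷≡[] : ∀ x y ys → below x (y ∷ ys) ≡ [] → ¬ y < x × below x ys ≡ []
  below-∷≡[] x y ys below≡[] with y <? x
  ... | yes y<x with () ← trans (sym (below-∷-< ys y<x)) below≡[]
  ... | no  y≮x = y≮x , trans (sym (below-∷-≮ ys y≮x)) below≡[]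

  rank≡1⇒below≡[] : ∀ u x → rank u x ≡ 1 → below x u ≡ []
  rank≡1⇒below≡[] u x rank≡1 = dedup≡[]⇒≡[] (below x u) (ℕP.suc-injective rank≡1)

  orderIso-1132⇒ : ∀ a b c d → OrderIso (a ∷ b ∷ c ∷ d ∷ []) pattern1132 → a ≡ b × a < d × d < c
  orderIso-1132⇒ a b c d iso = a≡b , a<d , d<c
    where
    u = a ∷ b ∷ c ∷ d ∷ []
    rank-a : rank u a ≡ 1
    rank-a = LP.∷-injectiveˡ iso
    rank-b : rank u b ≡ 1
    rank-b = LP.∷-injectiveˡ (LP.∷-injectiveʳ iso)
    rank-c : rank u c ≡ 3
    rank-c = LP.∷-injectiveˡ (LP.∷-injectiveʳ (LP.∷-injectiveʳ iso))
    rank-d : rank u d ≡ 2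
    rank-d = LP.∷-injectiveˡ (LP.∷-injectiveʳ (LP.∷-injectiveʳ (LP.∷-injectiveʳ iso)))

    below-a-tail = proj₂ (below-∷≡[] a a _ (rank≡1⇒below≡[] u a rank-a))
    b≮a : ¬ b < a
    b≮a = proj₁ (below-∷≡[] a b _ below-a-tail)
    c≮a : ¬ c < a
    c≮a = proj₁ (below-∷≡[] a c _ (proj₂ (below-∷≡[] a b _ below-a-tail)))
    a≮b : ¬ a < b
    a≮b = proj₁ (below-∷≡[] b a _ (rank≡1⇒below≡[] u b rank-b))

    a≡b : a ≡ b
    a≡b = ℕP.≤-antisym (ℕP.≮⇒≥ b≮a) (ℕP.≮⇒≥ a≮b)

    -- Otherwise nothing in u lies below d, and d would have rank 1.
    a<d : a < d
    a<d with a <? d | c <? d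
    ... | yes a<d | _       = a<d
    ... | no  _   | yes c<d = ℕP.≤-<-trans (ℕP.≮⇒≥ c≮a) c<d
    ... | no  a≮d | no  c≮d = contradiction (trans (sym (cong (suc ∘ length ∘ dedup) below-d≡[])) rank-d) λ ()
      where
      below-d≡[] : below d u ≡ []
      below-d≡[] = trans (below-∷-≮ _ a≮d) (trans (below-∷-≮ _ (subst (λ z → ¬ z < d) a≡b a≮d))
                   (trans (below-∷-≮ _ c≮d) (below-∷-≮ {d} {d} [] (ℕP.<-irrefl refl))))

    -- Otherwise the letters below c are among a = b, and c would have rank at most 2.
    d<c : d < c
    d<c with d <? c | a <? c
    ... | yes d<c | _       = d<c
    ... | no  d≮c | yes a<c = contradiction (trans (sym (cong (suc ∘ length) dedup-below-c)) rank-c) λ ()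
      where
      dedup-below-c : dedup (below c u) ≡ a ∷ []
      dedup-below-c = trans (cong dedup (trans (below-∷-< _ a<c) (cong (a ∷_) (trans (below-∷-< _ (subst (_< c) a≡b a<c))
                        (cong (b ∷_) (trans (below-∷-≮ {c} {c} (d ∷ []) (ℕP.<-irrefl refl)) (below-∷-≮ [] d≮c)))))))
                        (subst (λ z → dedup (a ∷ z ∷ []) ≡ a ∷ []) a≡b (dedup-∷∷ a))
    ... | no  d≮c | no  a≮c = contradiction (trans (sym (cong (suc ∘ length ∘ dedup) below-c≡[])) rank-c) λ ()
      where
      below-c≡[] : below c u ≡ []
      below-c≡[] = trans (below-∷-≮ _ a≮c) (trans (below-∷-≮ _ (subst (λ z → ¬ z < c) a≡b a≮c))
                   (trans (below-∷-≮ {c} {c} (d ∷ []) (ℕP.<-irrefl refl)) (below-∷-≮ [] d≮c)))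


module ContainsDecision where

  open import Defs
  open Counting using (has1132; anyBetween; between)
  open Pattern using (orderIso-1132⇒; orderIso-1132⇐)
  open import Data.Nat as ℕ using (ℕ; zero; suc; _<_; _≤_; z≤n; s≤s; _≟_; _<?_)
  import Data.Nat.Properties as ℕP
  open import Data.Fin using (Fin; toℕ; fromℕ<)
  import Data.Fin.Properties as FinP
  open import Data.Vec using (Vec; []; _∷_)
  open import Data.List using (List; []; _∷_; length)
  open import Data.Bool using (T; _∧_)
  open import Data.Bool.Properties using (T-≡; T-∧; T-∨)
  open import Data.Product using (_×_; _,_; ∃-syntax)
  open import Data.Sum using (inj₁; inj₂; [_,_]′)
  open import Function using (_⇔_; mk⇔; Equivalence)
  open import Relation.Nullary using (Dec; yes; does; map′)
  open import Relation.Nullary.Decidable using (does-≡; dec-true; T?)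
  open import Relation.Binary.PropositionalEquality using (_≡_; refl; cong; sym; trans; subst; subst₂)

  private
    T-does⇒ : ∀ {A : Set} (a? : Dec A) → T (does a?) → A
    T-does⇒ (yes a) _ = a

    T-does⇐ : ∀ {A : Set} (a? : Dec A) → A → T (does a?)
    T-does⇐ a? a = Equivalence.from T-≡ (dec-true a? a)

  letters : ∀ {n k} → Vec (Fin k) n → List ℕ
  letters []      = []
  letters (c ∷ w) = toℕ c ∷ letters w

  letterAt : List ℕ → ℕ → ℕ
  letterAt []       _       = 0
  letterAt (x ∷ xs) zero    = x
  letterAt (x ∷ xs) (suc i) = letterAt xs i

  at≡letterAt : ∀ {n k} (w : Vec (Fin k) n) i → at w i ≡ letterAt (letters w) i
  at≡letterAt []      i       = refl
  at≡letterAt (c ∷ w) zero    = refl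
  at≡letterAt (c ∷ w) (suc i) = at≡letterAt w i

  length-letters : ∀ {n k} (w : Vec (Fin k) n) → length (letters w) ≡ n
  length-letters []      = refl
  length-letters (c ∷ w) = cong suc (length-letters w)

  Occurs1132 : List ℕ → ℕ → ℕ → Set
  Occurs1132 L p q = letterAt L p ≡ letterAt L (suc p) × letterAt L p < letterAt L q × letterAt L q < letterAt L (suc (suc p))

  Contains1132 : List ℕ → Set
  Contains1132 L = ∃[ p ] ∃[ q ] q < length L × suc (suc (suc p)) ≤ q × Occurs1132 L p q

  Contains⇒Contains1132 : ∀ {n k} (w : Vec (Fin k) n) → Contains w → Contains1132 (letters w)
  Contains⇒Contains1132 w (p , q , 3+p≤q , iso) with orderIso-1132⇒ _ _ _ _ iso
  ... | a≡b , a<d , d<c =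
    toℕ p , toℕ q , subst (toℕ q <_) (sym (length-letters w)) (FinP.toℕ<n q) , 3+p≤q ,
    trans (sym (at≡letterAt w _)) (trans a≡b (at≡letterAt w _)) ,
    subst₂ _<_ (at≡letterAt w _) (at≡letterAt w _) a<d ,
    subst₂ _<_ (at≡letterAt w _) (at≡letterAt w _) d<c

  Contains1132⇒Contains : ∀ {n k} (w : Vec (Fin k) n) → Contains1132 (letters w) → Contains w
  Contains1132⇒Contains {n} w (p , q , q<len , 3+p≤q , (a≡b , a<d , d<c)) =
    fromℕ< p<n , fromℕ< q<n ,
    subst₂ (λ x y → suc (suc (suc x)) ≤ y) (sym (FinP.toℕ-fromℕ< p<n)) (sym (FinP.toℕ-fromℕ< q<n)) 3+p≤q ,
    subst₂ (λ x y → OrderIso (sub4 w x y) pattern1132) (sym (FinP.toℕ-fromℕ< p<n)) (sym (FinP.toℕ-fromℕ< q<n)) iso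
    where
    q<n : q < n
    q<n = subst (q <_) (length-letters w) q<len
    p<n : p < n
    p<n = ℕP.<-trans (ℕP.<-≤-trans (ℕP.m<n+m p (s≤s (z≤n {2}))) 3+p≤q) q<n
    a = at w p
    c = at w (suc (suc p))
    d = at w q
    iso : OrderIso (sub4 w p q) pattern1132
    iso = subst (λ z → OrderIso (a ∷ z ∷ c ∷ d ∷ []) pattern1132)
                (trans (at≡letterAt w p) (trans a≡b (sym (at≡letterAt w (suc p)))))
                (orderIso-1132⇐ a c d (subst₂ _<_ (sym (at≡letterAt w p)) (sym (at≡letterAt w q)) a<d)
                                      (subst₂ _<_ (sym (at≡letterAt w q)) (sym (at≡letterAt w _)) d<c))

  T-anyBetween⇒ : ∀ a c r → T (anyBetween a c r) → ∃[ i ] i < length r × a < letterAt r i × letterAt r i < c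
  T-anyBetween⇒ a c (d ∷ r) t with Equivalence.to T-∨ t
  ... | inj₁ t-here with Equivalence.to T-∧ t-here
  ...   | a<d , d<c = 0 , s≤s z≤n , T-does⇒ (a <? d) a<d , T-does⇒ (d <? c) d<c
  T-anyBetween⇒ a c (d ∷ r) t | inj₂ t-there with T-anyBetween⇒ a c r t-there
  ...   | i , i<len , a<x , x<c = suc i , s≤s i<len , a<x , x<c

  T-anyBetween⇐ : ∀ a c r i → i < length r → a < letterAt r i → letterAt r i < c → T (anyBetween a c r)
  T-anyBetween⇐ a c (d ∷ r) zero    _           a<d d<c =
    Equivalence.from T-∨ (inj₁ (Equivalence.from T-∧ (T-does⇐ (a <? d) a<d , T-does⇐ (d <? c) d<c)))
  T-anyBetween⇐ a c (d ∷ r) (suc i) (s≤s i<len) a<x x<c =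
    Equivalence.from (T-∨ {between a c d}) (inj₂ (T-anyBetween⇐ a c r i i<len a<x x<c))

  Contains1132-∷ : ∀ a L → Contains1132 L → Contains1132 (a ∷ L)
  Contains1132-∷ a L (p , q , q<len , 3+p≤q , occ) = suc p , suc q , s≤s q<len , s≤s 3+p≤q , occ

  Contains1132-head : ∀ a b c r → T (does (a ≟ b) ∧ anyBetween a c r) → Contains1132 (a ∷ b ∷ c ∷ r)
  Contains1132-head a b c r t with Equivalence.to T-∧ t
  ... | a≡b , t-between with T-anyBetween⇒ a c r t-between
  ...   | i , i<len , a<x , x<c =
    0 , suc (suc (suc i)) , s≤s (s≤s (s≤s i<len)) , s≤s (s≤s (s≤s z≤n)) , T-does⇒ (a ≟ b) a≡b , a<x , x<c

  T-has1132⇒ : ∀ L → T (has1132 L) → Contains1132 L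
  T-has1132⇒ (a ∷ b ∷ c ∷ r) t =
    [ Contains1132-head a b c r , (λ t-tail → Contains1132-∷ a _ (T-has1132⇒ (b ∷ c ∷ r) t-tail)) ]′ (Equivalence.to T-∨ t)

  T-has1132⇐ : ∀ L → Contains1132 L → T (has1132 L)
  T-has1132⇐ []               (_ , _ , () , _)
  T-has1132⇐ (a ∷ [])         (_ , _ , s≤s () , s≤s (s≤s (s≤s _)) , _)
  T-has1132⇐ (a ∷ b ∷ [])     (_ , _ , s≤s (s≤s ()) , s≤s (s≤s (s≤s _)) , _)
  T-has1132⇐ (a ∷ b ∷ c ∷ r) (zero , zero , _ , () , _)
  T-has1132⇐ (a ∷ b ∷ c ∷ r) (zero , suc zero , _ , s≤s () , _)
  T-has1132⇐ (a ∷ b ∷ c ∷ r) (zero , suc (suc zero) , _ , s≤s (s≤s ()) , _)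
  T-has1132⇐ (a ∷ b ∷ c ∷ r) (zero , suc (suc (suc i)) , s≤s (s≤s (s≤s i<len)) , _ , (a≡b , a<x , x<c)) =
    Equivalence.from T-∨ (inj₁ (Equivalence.from T-∧ (T-does⇐ (a ≟ b) a≡b , T-anyBetween⇐ a c r i i<len a<x x<c)))
  T-has1132⇐ (a ∷ b ∷ c ∷ r) (suc p , suc q , s≤s q<len , s≤s 3+p≤q , occ) =
    Equivalence.from (T-∨ {does (a ≟ b) ∧ anyBetween a c r}) (inj₂ (T-has1132⇐ (b ∷ c ∷ r) (p , q , q<len , 3+p≤q , occ)))

  Contains⇔T-has1132 : ∀ {n k} (w : Vec (Fin k) n) → Contains w ⇔ T (has1132 (letters w))
  Contains⇔T-has1132 w = mk⇔ (λ c → T-has1132⇐ (letters w) (Contains⇒Contains1132 w c))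
                             (λ t → Contains1132⇒Contains w (T-has1132⇒ (letters w) t))

  does-contains? : ∀ {n k} (w : Vec (Fin k) n) → does (contains? w) ≡ has1132 (letters w)
  does-contains? w = does-≡ (contains? w) (map′ from to (T? (has1132 (letters w))))
    where open Equivalence (Contains⇔T-has1132 w)


module AvoiderCount where

  open import Defs
  open Counting using (module Σℕ; count; has1132; avoiding)
  open ContainsDecision using (letters; does-contains?)
  open import Data.Nat as ℕ using (ℕ; zero; suc; _+_)
  open import Data.Fin using (Fin; toℕ)
  open import Data.Vec using (Vec; []; _∷_)
  open import Data.List using (List; []; _∷_; length; filter; map; concatMap; _++_; tabulate; allFin)
  open import Data.Nat.ListAction using (sum)
  import Data.List.Properties as LP
  open import Data.Bool using (Bool; true; false; not; if_then_else_)
  open import Relation.Nullary using (does; ¬?)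
  open import Relation.Unary using (Pred; Decidable)
  open import Function using (_∘_; id)
  open import Level using (0ℓ)
  open import Relation.Binary.PropositionalEquality using (_≡_; refl; cong; sym; trans; module ≡-Reasoning)
  open ≡-Reasoning

  length-filter-map : ∀ {A B : Set} {Q : Pred B 0ℓ} (Q? : Decidable Q) (g : A → B) xs →
    length (filter Q? (map g xs)) ≡ length (filter (Q? ∘ g) xs)
  length-filter-map Q? g []       = refl
  length-filter-map Q? g (x ∷ xs) with does (Q? (g x))
  ... | true  = cong suc (length-filter-map Q? g xs)
  ... | false = length-filter-map Q? g xs

  length-filter-concatMap : ∀ {A B : Set} {Q : Pred B 0ℓ} (Q? : Decidable Q) (F : A → List B) xs →
    length (filter Q? (concatMap F xs)) ≡ sum (map (λ x → length (filter Q? (F x))) xs)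
  length-filter-concatMap Q? F []       = refl
  length-filter-concatMap Q? F (x ∷ xs) = begin
    length (filter Q? (F x ++ concatMap F xs))                 ≡⟨ cong length (LP.filter-++ Q? (F x) (concatMap F xs)) ⟩
    length (filter Q? (F x) ++ filter Q? (concatMap F xs))     ≡⟨ LP.length-++ (filter Q? (F x)) ⟩
    length (filter Q? (F x)) + length (filter Q? (concatMap F xs)) ≡⟨ cong (length (filter Q? (F x)) +_) (length-filter-concatMap Q? F xs) ⟩
    sum (map (λ x → length (filter Q? (F x))) (x ∷ xs))         ∎

  sum-tabulate-toℕ : ∀ k (f : ℕ → ℕ) → sum (tabulate {n = k} (f ∘ toℕ)) ≡ Σℕ.Σ k f
  sum-tabulate-toℕ zero    f = refl
  sum-tabulate-toℕ (suc k) f = trans (cong (f 0 +_) (sum-tabulate-toℕ k (f ∘ suc))) (sym (Σℕ.Σ-head k f))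

  length-filter-allWords : ∀ n k {Q : Pred (Vec (Fin k) n) 0ℓ} (Q? : Decidable Q) (P : List ℕ → Bool) →
    (∀ w → does (Q? w) ≡ P (letters w)) → length (filter Q? (allWords n k)) ≡ count n k P
  length-filter-allWords zero k Q? P Q≡P with does (Q? []) | Q≡P []
  ... | true  | Q≡P[] = cong (λ b → if b then 1 else 0) Q≡P[]
  ... | false | Q≡P[] = cong (λ b → if b then 1 else 0) Q≡P[]
  length-filter-allWords (suc n) k Q? P Q≡P = begin
    length (filter Q? (concatMap (λ c → map (c ∷_) (allWords n k)) (allFin k)))
      ≡⟨ length-filter-concatMap Q? (λ c → map (c ∷_) (allWords n k)) (allFin k) ⟩
    sum (map (λ c → length (filter Q? (map (c ∷_) (allWords n k)))) (allFin k))
      ≡⟨ cong sum (LP.map-tabulate {n = k} id (λ c → length (filter Q? (map (c ∷_) (allWords n k))))) ⟩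
    sum (tabulate (λ c → length (filter Q? (map (c ∷_) (allWords n k)))))
      ≡⟨ cong sum (LP.tabulate-cong {n = k} (λ c → trans (length-filter-map Q? (c ∷_) (allWords n k))
                                                 (length-filter-allWords n k (Q? ∘ (c ∷_)) (λ l → P (toℕ c ∷ l)) (Q≡P ∘ (c ∷_))))) ⟩
    sum (tabulate {n = k} (λ c → count n k (λ l → P (toℕ c ∷ l))))
      ≡⟨ sum-tabulate-toℕ k (λ c → count n k (λ l → P (c ∷ l))) ⟩
    count (suc n) k P ∎

  avoiders≡avoiding : ∀ n k → avoiders n k ≡ avoiding n k
  avoiders≡avoiding n k =
    length-filter-allWords n k (λ w → ¬? (contains? w)) (λ l → not (has1132 l)) (λ w → cong not (does-contains? w))


module AvoiderRecurrence where

  open import Defs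
  open RationalSum
  open Counting using (module Σℕ; avoiding; avoidingFrom; avoidingFrom-suc-suc)
  open AvoiderCount using (avoiders≡avoiding)
  open import Data.Nat as ℕ using (ℕ; zero; suc; _∸_; _≤_; _<_; z≤n; s≤s; _<?_)
  import Data.Nat.Properties as ℕP
  open import Data.Nat.Coprimality using (1-coprimeTo) renaming (sym to coprime-sym)
  open import Data.Integer as ℤ using ()
  import Data.Integer.Properties as ℤP
  open import Data.Rational as ℚ using (ℚ; 0ℚ; 1ℚ; mkℚ; _+_; _-_)
  import Data.Rational.Properties as ℚP
  open import Data.Bool using (if_then_else_)
  open import Relation.Nullary using (¬_; does)
  open import Relation.Nullary.Decidable using (dec-true; dec-false)
  open import Relation.Binary.PropositionalEquality as P using (_≡_; refl; cong; cong₂; sym; trans)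
  open P.≡-Reasoning

  fromℕ≡mkℚ : ∀ n → fromℕ n ≡ mkℚ (ℤ.+ n) 0 (coprime-sym (1-coprimeTo n))
  fromℕ≡mkℚ n = ℚP.normalize-coprime (coprime-sym (1-coprimeTo n))

  fromℕ-+ : ∀ a b → fromℕ (a ℕ.+ b) ≡ fromℕ a + fromℕ b
  fromℕ-+ a b rewrite fromℕ≡mkℚ a | fromℕ≡mkℚ b =
    sym (cong₂ (λ x y → (x ℤ.+ y) ℚ./ 1) (ℤP.*-identityʳ (ℤ.+ a)) (ℤP.*-identityʳ (ℤ.+ b)))

  fromℕ-Σ : ∀ k f → fromℕ (Σℕ.Σ k f) ≡ Σ< k (λ i → fromℕ (f i))
  fromℕ-Σ zero    f = refl
  fromℕ-Σ (suc k) f = trans (fromℕ-+ (Σℕ.Σ k f) (f k)) (cong (_+ fromℕ (f k)) (fromℕ-Σ k f))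

  ∸≡suc⇒≤ : ∀ m n {o} → m ∸ n ≡ suc o → n ≤ m
  ∸≡suc⇒≤ m       zero    _ = z≤n
  ∸≡suc⇒≤ (suc m) (suc n) e = s≤s (∸≡suc⇒≤ m n e)

  -- In Φ-rec the a′-th term of the relabelled sum lives over the alphabet k - (a - 1 - a′),
  -- where s + 1 (with s = k - 1 - a) is the (a′+1)-th largest letter.
  module _ {a′ a k : ℕ} (a′<a : a′ < a) (a<k : a < k) where

    shrunk-letter : (k ∸ (a ∸ suc a′)) ∸ suc a′ ≡ suc (k ∸ suc a)
    shrunk-letter = begin
      (k ∸ (a ∸ suc a′)) ∸ suc a′ ≡⟨ ℕP.∸-+-assoc k (a ∸ suc a′) (suc a′) ⟩
      k ∸ (a ∸ suc a′ ℕ.+ suc a′) ≡⟨ cong (k ∸_) (ℕP.m∸n+n≡m a′<a) ⟩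
      k ∸ a                       ≡⟨ ℕP.+-∸-assoc 1 a<k ⟩
      suc (k ∸ suc a)             ∎

    shrunk-alphabet : suc (k ∸ suc a) ℕ.+ (k ∸ (k ∸ suc a′)) ≡ k ∸ (a ∸ suc a′)
    shrunk-alphabet = begin
      suc (k ∸ suc a) ℕ.+ (k ∸ (k ∸ suc a′))          ≡⟨ cong (suc (k ∸ suc a) ℕ.+_) (ℕP.m∸[m∸n]≡n (ℕP.<-trans a′<a a<k)) ⟩
      suc (k ∸ suc a) ℕ.+ suc a′                      ≡⟨ cong (ℕ._+ suc a′) (sym shrunk-letter) ⟩
      (k ∸ (a ∸ suc a′)) ∸ suc a′ ℕ.+ suc a′          ≡⟨ ℕP.m∸n+n≡m (∸≡suc⇒≤ (k ∸ (a ∸ suc a′)) (suc a′) shrunk-letter) ⟩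
      k ∸ (a ∸ suc a′)                                ∎

  ∸-suc-< : ∀ {a k} → a < k → k ∸ suc a < k
  ∸-suc-< {a} {suc k} _ = s≤s (ℕP.m∸n≤m k a)

  -- The letters e > k - 1 - a of [0, k) are e = k - 1 - a′ for a′ < a.
  Σ<-above-reindex : ∀ a k (f : ℕ → ℕ) → a < k →
    Σ< k (λ e → fromℕ (if does (k ∸ suc a <? e) then f e else 0)) ≡ Σ< a (λ a′ → fromℕ (f (k ∸ suc a′)))
  Σ<-above-reindex a k f a<k = begin
    Σ< k g                                             ≡⟨ cong (λ m → Σ< m g) (sym k≡) ⟩
    Σ< (suc s ℕ.+ a) g                                 ≡⟨ Σ<-split (suc s) a g ⟩
    Σ< (suc s) g + Σ< a (λ i → g (suc s ℕ.+ i))        ≡⟨ cong₂ _+_ (Σ<-zero (suc s) (λ e e≤s → cong fromℕ (if-false (ℕP.≤⇒≯ (ℕP.≤-pred e≤s)))))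
                                                                    (Σ<-cong a (λ i → cong fromℕ (if-true (s≤s (ℕP.m≤m+n s i))))) ⟩
    0ℚ + Σ< a (λ i → fromℕ (f (suc s ℕ.+ i)))          ≡⟨ ℚP.+-identityˡ _ ⟩
    Σ< a (λ i → fromℕ (f (suc s ℕ.+ i)))               ≡⟨ Σ<-reverse a _ ⟩
    Σ< a (λ i → fromℕ (f (suc s ℕ.+ (a ∸ suc i))))     ≡⟨ Σ<-cong< a (λ i i<a → cong (λ x → fromℕ (f x))
                                                               (trans (sym (ℕP.+-∸-assoc (suc s) i<a)) (cong (_∸ suc i) k≡))) ⟩
    Σ< a (λ a′ → fromℕ (f (k ∸ suc a′)))               ∎
    where
    s = k ∸ suc a
    g : ℕ → ℚ
    g e = fromℕ (if does (s <? e) then f e else 0)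
    k≡ : suc s ℕ.+ a ≡ k
    k≡ = trans (sym (ℕP.+-suc s a)) (ℕP.m∸n+n≡m a<k)
    if-true : ∀ {e} → s < e → (if does (s <? e) then f e else 0) ≡ f e
    if-true {e} s<e = cong (λ b → if b then f e else 0) (dec-true (s <? e) s<e)
    if-false : ∀ {e} → ¬ s < e → (if does (s <? e) then f e else 0) ≡ 0
    if-false {e} s≮e = cong (λ b → if b then f e else 0) (dec-false (s <? e) s≮e)

  -- Φ a k n counts the avoiders of length n over [k] whose first letter is the (a+1)-th largest, k - a.
  Φ : ℕ → ℕ → ℕ → ℚ
  Φ a k zero    = 0ℚ
  Φ a k (suc n) = fromℕ (avoidingFrom (k ∸ suc a) k n)

  avoiders-first-letter : ∀ k n → fromℕ (avoiders n k) ≡ δ0 n + Σ< k (λ a → Φ a k n)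
  avoiders-first-letter k zero = trans (cong fromℕ (avoiders≡avoiding 0 k))
    (sym (trans (cong (1ℚ +_) (Σ<-zero k (λ _ _ → refl))) (ℚP.+-identityʳ 1ℚ)))
  avoiders-first-letter k (suc n) = begin
    fromℕ (avoiders (suc n) k)                             ≡⟨ cong fromℕ (avoiders≡avoiding (suc n) k) ⟩
    fromℕ (Σℕ.Σ k (λ s → avoidingFrom s k n))              ≡⟨ fromℕ-Σ k (λ s → avoidingFrom s k n) ⟩
    Σ< k (λ s → fromℕ (avoidingFrom s k n))                ≡⟨ Σ<-reverse k _ ⟩
    Σ< k (λ a → Φ a k (suc n))                             ≡⟨ sym (ℚP.+-identityˡ _) ⟩
    0ℚ + Σ< k (λ a → Φ a k (suc n))                        ∎

  Φ-rec : ∀ a k n → a < k →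
    Φ a k (suc (suc n)) ≡ fromℕ (avoiders (suc n) k) - Σ< a (λ a′ → Φ a′ k n - Φ a′ (k ∸ (a ∸ suc a′)) n)
  Φ-rec a k zero a<k = begin
    fromℕ (avoidingFrom (k ∸ suc a) k 1)                    ≡⟨ cong fromℕ (sym (avoiders≡avoiding 1 k)) ⟩
    fromℕ (avoiders 1 k)                                    ≡⟨ sym (ℚP.+-identityʳ _) ⟩
    fromℕ (avoiders 1 k) + ℚ.- 0ℚ                           ≡⟨ cong (λ z → fromℕ (avoiders 1 k) - z) (sym (Σ<-zero a (λ _ _ → ℚP.+-inverseʳ 0ℚ))) ⟩
    fromℕ (avoiders 1 k) - Σ< a (λ a′ → 0ℚ - 0ℚ)            ∎
  Φ-rec a k (suc n) a<k = begin
    F                                   ≡⟨ move F larger ⟩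
    (F + larger) - larger               ≡⟨ cong (_- larger) identity ⟩
    (W + relabeled) - larger            ≡⟨ regroup W larger relabeled ⟩
    W - (larger - relabeled)            ≡⟨ cong₂ _-_ (cong fromℕ (sym (avoiders≡avoiding (suc (suc n)) k)))
                                                     (sym (Σ<-sub a (λ a′ → Φ a′ k (suc n)) (λ a′ → Φ a′ (k ∸ (a ∸ suc a′)) (suc n)))) ⟩
    fromℕ (avoiders (suc (suc n)) k) - Σ< a (λ a′ → Φ a′ k (suc n) - Φ a′ (k ∸ (a ∸ suc a′)) (suc n)) ∎
    where
    s = k ∸ suc a
    F W larger relabeled : ℚ
    F = fromℕ (avoidingFrom s k (suc (suc n)))
    W = fromℕ (avoiding (suc (suc n)) k)
    larger = Σ< a (λ a′ → Φ a′ k (suc n))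
    relabeled = Σ< a (λ a′ → Φ a′ (k ∸ (a ∸ suc a′)) (suc n))
    largerℕ relabeledℕ : ℕ
    largerℕ = Σℕ.Σ k (λ e → if does (s <? e) then avoidingFrom e k n else 0)
    relabeledℕ = Σℕ.Σ k (λ e → if does (s <? e) then avoidingFrom (suc s) (suc s ℕ.+ (k ∸ e)) n else 0)
    larger≡ : fromℕ largerℕ ≡ larger
    larger≡ = trans (fromℕ-Σ k _) (Σ<-above-reindex a k (λ e → avoidingFrom e k n) a<k)
    relabeled≡ : fromℕ relabeledℕ ≡ relabeled
    relabeled≡ = trans (fromℕ-Σ k _) (trans (Σ<-above-reindex a k (λ e → avoidingFrom (suc s) (suc s ℕ.+ (k ∸ e)) n) a<k)
                   (Σ<-cong< a (λ a′ a′<a → cong fromℕ (cong₂ (λ x y → avoidingFrom x y n)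
                                                         (sym (shrunk-letter a′<a a<k)) (shrunk-alphabet a′<a a<k)))))
    identity : F + larger ≡ W + relabeled
    identity = begin
      F + larger                                         ≡⟨ cong (F +_) (sym larger≡) ⟩
      F + fromℕ largerℕ                                  ≡⟨ sym (fromℕ-+ (avoidingFrom s k (suc (suc n))) largerℕ) ⟩
      fromℕ (avoidingFrom s k (suc (suc n)) ℕ.+ largerℕ) ≡⟨ cong fromℕ (avoidingFrom-suc-suc s k n (∸-suc-< a<k)) ⟩
      fromℕ (avoiding (suc (suc n)) k ℕ.+ relabeledℕ)    ≡⟨ fromℕ-+ (avoiding (suc (suc n)) k) relabeledℕ ⟩
      W + fromℕ relabeledℕ                               ≡⟨ cong (W +_) relabeled≡ ⟩
      W + relabeled                                      ∎
    open ℚ-Solver using (solve; _:=_; _:+_; _:-_)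
    move : ∀ f l → f ≡ (f + l) - l
    move = solve 2 (λ f l → f := (f :+ l) :- l) refl
    regroup : ∀ w l r → (w + r) - l ≡ w - (l - r)
    regroup = solve 3 (λ w l r → (w :+ r) :- l := w :- (l :- r)) refl


module Matching where

  open import Defs
  open RationalSum
  open Bivariate
  open Psi using (ψ)
  open PsiIdentity using (D; D-term; ψ≈x-x²D)
  open PsiDegree using (ψ-degreeY)
  open AvoiderCount using (avoiders≡avoiding)
  open AvoiderRecurrence using (Φ; Φ-rec; shrunk-letter; ∸≡suc⇒≤)
  open import Data.Nat as ℕ using (ℕ; zero; suc; _∸_; _≤_; _<_; s≤s)
  import Data.Nat.Properties as ℕP
  open import Data.Rational as ℚ using (ℚ; 0ℚ; 1ℚ; _+_; _-_; _*_)
  import Data.Rational.Properties as ℚP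
  open import Algebra.Bundles using (CommutativeRing)
  open import Relation.Binary.PropositionalEquality using (_≡_; cong; cong₂; sym; trans; module ≡-Reasoning)
  open ≡-Reasoning

  avoidersℚ : ℕ → ℕ → ℚ
  avoidersℚ n k = fromℕ (avoiders n k)

  open Pairing avoidersℚ public

  private
    module R = CommutativeRing P2-ring

  X≋X⊗1 : X ≋ (X ⊗ cst 1ℚ)
  X≋X⊗1 = R.sym (R.*-identityʳ X)

  pair-ψ : ∀ a k N → pair (ψ a) k N ≡ pair X k N - pair (X ⊗ (X ⊗ D a)) k N
  pair-ψ a k N = trans (pair-cong (ψ≈x-x²D a) k N) (pair-sub X (X ⊗ (X ⊗ D a)) k N)

  pair-D : ∀ a k n → a < k → pair (D a) k n ≡ Σ< a (λ a′ → pair (ψ a′) k n - pair (ψ a′) (k ∸ (a ∸ suc a′)) n)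
  pair-D a k n a<k = trans (pair-Σ a (D-term a) k n) (Σ<-cong a λ a′ →
    trans (pair-sub (ψ a′) (pow Y (a ∸ suc a′) ⊗ ψ a′) k n)
          (cong (pair (ψ a′) k n -_) (pair-pow-Y⊗ (a ∸ suc a′) (ψ a′) k n (ℕP.≤-trans (ℕP.m∸n≤m a (suc a′)) (ℕP.<⇒≤ a<k)))))

  -- Φ and the pairing with ψ satisfy the same recurrence in n with the same two initial values.
  Φ≡pair-ψ : ∀ a k N → a < k → Φ a k N ≡ pair (ψ a) k N
  Φ≡pair-ψ a k zero a<k = sym (begin
    pair (ψ a) k 0                              ≡⟨ pair-ψ a k 0 ⟩
    pair X k 0 - pair (X ⊗ (X ⊗ D a)) k 0       ≡⟨ cong₂ _-_ (trans (pair-cong X≋X⊗1 k 0) (pair-X⊗-zero (cst 1ℚ) k)) (pair-X⊗-zero (X ⊗ D a) k) ⟩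
    0ℚ - 0ℚ                                     ≡⟨ ℚP.+-inverseʳ 0ℚ ⟩
    0ℚ                                          ∎)
  Φ≡pair-ψ a (suc k) (suc zero) a<k = sym (begin
    pair (ψ a) (suc k) 1                        ≡⟨ pair-ψ a (suc k) 1 ⟩
    pair X (suc k) 1 - pair (X ⊗ (X ⊗ D a)) (suc k) 1
      ≡⟨ cong₂ _-_ (trans (pair-cong X≋X⊗1 (suc k) 1) (trans (pair-X⊗-suc (cst 1ℚ) (suc k) 0) (pair-1 k 0)))
                   (trans (pair-X⊗-suc (X ⊗ D a) (suc k) 0) (pair-X⊗-zero (D a) (suc k))) ⟩
    avoidersℚ 0 (suc k) - 0ℚ                    ≡⟨ ℚP.+-identityʳ _ ⟩
    avoidersℚ 0 (suc k)                         ≡⟨ cong fromℕ (avoiders≡avoiding 0 (suc k)) ⟩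
    Φ a (suc k) 1                               ∎)
  Φ≡pair-ψ a (suc k) (suc (suc n)) a<k = begin
    Φ a (suc k) (suc (suc n))
      ≡⟨ Φ-rec a (suc k) n a<k ⟩
    avoidersℚ (suc n) (suc k) - Σ< a (λ a′ → Φ a′ (suc k) n - Φ a′ (suc k ∸ (a ∸ suc a′)) n)
      ≡⟨ cong₂ _-_ (sym (pair-X k (suc n))) (Σ<-cong< a induction) ⟩
    pair X (suc k) (suc (suc n)) - Σ< a (λ a′ → pair (ψ a′) (suc k) n - pair (ψ a′) (suc k ∸ (a ∸ suc a′)) n)
      ≡⟨ cong (pair X (suc k) (suc (suc n)) -_) (sym (trans (pair-X⊗-suc (X ⊗ D a) (suc k) (suc n))
                                                        (trans (pair-X⊗-suc (D a) (suc k) n) (pair-D a (suc k) n a<k)))) ⟩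
    pair X (suc k) (suc (suc n)) - pair (X ⊗ (X ⊗ D a)) (suc k) (suc (suc n))
      ≡⟨ sym (pair-ψ a (suc k) (suc (suc n))) ⟩
    pair (ψ a) (suc k) (suc (suc n)) ∎
    where
    pair-X : ∀ k N → pair X (suc k) (suc N) ≡ avoidersℚ N (suc k)
    pair-X k N = trans (pair-cong X≋X⊗1 (suc k) (suc N)) (trans (pair-X⊗-suc (cst 1ℚ) (suc k) N) (pair-1 k N))
    induction : ∀ a′ → a′ < a → Φ a′ (suc k) n - Φ a′ (suc k ∸ (a ∸ suc a′)) n
                                ≡ pair (ψ a′) (suc k) n - pair (ψ a′) (suc k ∸ (a ∸ suc a′)) n
    induction a′ a′<a = cong₂ _-_ (Φ≡pair-ψ a′ (suc k) n (ℕP.<-trans a′<a a<k))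
      (Φ≡pair-ψ a′ (suc k ∸ (a ∸ suc a′)) n (∸≡suc⇒≤ _ _ (shrunk-letter a′<a a<k)))

  -- Since ψ a has y-degree at most a, only the a ≥ j summands contribute to the coefficient of y^j.
  Σ-pair-ψ : ∀ k n → Σ< k (λ a → pair (ψ a) k n)
                     ≡ Σ< k (λ j → Σ< (k ∸ j) (λ t → Σ< (suc n) (λ m → ψ (j ℕ.+ t) m j * avoidersℚ (n ∸ m) (k ∸ j))))
  Σ-pair-ψ k n = trans (Σ<-swap k k term) (Σ<-cong< k drop-low)
    where
    term : ℕ → ℕ → ℚ
    term a j = Σ< (suc n) (λ m → ψ a m j * avoidersℚ (n ∸ m) (k ∸ j))
    drop-low : ∀ j → j < k → Σ< k (λ a → term a j) ≡ Σ< (k ∸ j) (λ t → term (j ℕ.+ t) j)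
    drop-low j j<k = begin
      Σ< k (λ a → term a j)                                         ≡⟨ cong (λ x → Σ< x (λ a → term a j)) (sym (ℕP.m+[n∸m]≡n (ℕP.<⇒≤ j<k))) ⟩
      Σ< (j ℕ.+ (k ∸ j)) (λ a → term a j)                           ≡⟨ Σ<-split j (k ∸ j) (λ a → term a j) ⟩
      Σ< j (λ a → term a j) + Σ< (k ∸ j) (λ t → term (j ℕ.+ t) j)   ≡⟨ cong (_+ Σ< (k ∸ j) (λ t → term (j ℕ.+ t) j)) (Σ<-zero j low) ⟩
      0ℚ + Σ< (k ∸ j) (λ t → term (j ℕ.+ t) j)                      ≡⟨ ℚP.+-identityˡ _ ⟩
      Σ< (k ∸ j) (λ t → term (j ℕ.+ t) j)                           ∎
      where
      low : ∀ a → a < j → term a j ≡ 0ℚ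
      low a a<j = Σ<-zero (suc n) (λ m _ → trans (cong (_* avoidersℚ (n ∸ m) (k ∸ j)) (ψ-degreeY a m j a<j))
                                                 (ℚP.*-zeroˡ (avoidersℚ (n ∸ m) (k ∸ j))))


open import Defs
open import Data.Nat using (ℕ; suc; _+_; _∸_)
open import Data.Rational using (ℚ) renaming (_+_ to _+ℚ_; _*_ to _*ℚ_)
open import Relation.Binary.PropositionalEquality using (_≡_; cong; sym; module ≡-Reasoning)
open ≡-Reasoning
open RationalSum using (Σ<-cong; Σ<-cong<)
open Psi using (ψ; coefA≡ψ)
open AvoiderRecurrence using (Φ; avoiders-first-letter)
open Matching using (pair; avoidersℚ; Φ≡pair-ψ; Σ-pair-ψ)

theorem4p5 : (k n : ℕ) →
    fromℕ (avoiders n k) ≡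
    δ0 n +ℚ Σ< k (λ j → Σ< (k ∸ j) (λ t → Σ< (suc n) (λ m →
    coefA (j + t) j m *ℚ fromℕ (avoiders (n ∸ m) (k ∸ j)))))
theorem4p5 k n = begin
  fromℕ (avoiders n k)                      ≡⟨ avoiders-first-letter k n ⟩
  δ0 n +ℚ Σ< k (λ a → Φ a k n)              ≡⟨ cong (δ0 n +ℚ_) (Σ<-cong< k (λ a a<k → Φ≡pair-ψ a k n a<k)) ⟩
  δ0 n +ℚ Σ< k (λ a → pair (ψ a) k n)       ≡⟨ cong (δ0 n +ℚ_) (Σ-pair-ψ k n) ⟩
  δ0 n +ℚ Σ< k (λ j → Σ< (k ∸ j) (λ t → Σ< (suc n) (λ m → ψ (j + t) m j *ℚ avoidersℚ (n ∸ m) (k ∸ j))))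
    ≡⟨ cong (δ0 n +ℚ_) (Σ<-cong k (λ j → Σ<-cong (k ∸ j) (λ t → Σ<-cong (suc n) (λ m →
         cong (_*ℚ avoidersℚ (n ∸ m) (k ∸ j)) (sym (coefA≡ψ (j + t) j m)))))) ⟩
  δ0 n +ℚ Σ< k (λ j → Σ< (k ∸ j) (λ t → Σ< (suc n) (λ m → coefA (j + t) j m *ℚ avoidersℚ (n ∸ m) (k ∸ j)))) ∎
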